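{- Let $G$ be a minimal counterexample (as defined in the context) and let $H$ be obtained from $G$ by deleting all vertices of degree $1$. Let $v$ be a $4$-vertex of $H$ with neighbors $v_1,v_2,v_3,v_4$ in $H$, where $v_1$ and $v_2$ are $2_1$-vertices. Then each of $v_3$ and $v_4$ is neither a $2$-vertex of $H$ nor a poor $3$-vertex of $H$.
   Context: All graphs are finite and simple. $\mathrm{mad}(G)=\max\{2|E(F)|/|V(F)|:F\subseteq G\}$. Two edges are at distance two if they share no endpoint and an endpoint of one is adjacent to an endpoint of the other. An injective $k$-edge-coloring of $G$ is a map $\phi:E(G)\to\{1,\dots,k\}$ with $\phi(e)\neq\phi(e')$ whenever $e,e'$ are at distance two or lie in a common triangle; $\chi_i'(G)$ is the least such $k$. A minimal counterexample is a connected graph $G$ with $\Delta(G)\le 4$, $\mathrm{mad}(G)<\frac83$ and $\chi_i'(G)>7$, such that every graph $G'$ with $\Delta(G')\le4$, $\mathrm{mad}(G')<\frac83$ and $|V(G')|+|E(G')|<|V(G)|+|E(G)|$ satisfies $\chi_i'(G')\le 7$. In $H$: a $k$-vertex is a vertex of degree $k$ in $H$; a $k_j$-vertex is a $k$-vertex of $H$ adjacent in $H$ to exactly $j$ vertices of degree $2$ in $H$; a $3_{1^+}$-vertex is a $3_1$-vertex adjacent in $H$ to a $2_1$-vertex; a $3$-vertex of $H$ is poor if it is a $3_{1^+}$-vertex or a $3_2$-vertex. -}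

module Defs where

open import Data.Nat using (ℕ; zero; suc; _+_; _*_; _≤_; _<_; _<ᵇ_)
open import Data.Bool using (Bool; true; false; if_then_else_; _∧_)
open import Data.Fin using (Fin; toℕ)
open import Data.List using (List; map; allFin)
open import Data.Nat.ListAction using (sum)
open import Data.Product using (Σ; _×_; _,_)
open import Data.Sum using (_⊎_)
open import Relation.Binary.PropositionalEquality using (_≡_; _≢_)
open import Relation.Nullary using (¬_)

record Graph : Set where
  field
    n      : ℕ
    adj    : Fin n → Fin n → Bool
    adj-sym     : ∀ i j → adj i j ≡ adj j i
    adj-irrefl  : ∀ i → adj i i ≡ false
open Graph public

count : {m : ℕ} → (Fin m → Bool) → ℕ
count {m} p = sum (map (λ i → if p i then 1 else 0) (allFin m))

countPairs : {m : ℕ} → (Fin m → Fin m → Bool) → ℕ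
countPairs {m} r = sum (map (λ i → count (λ j → r i j ∧ (toℕ i <ᵇ toℕ j))) (allFin m))

deg : (G : Graph) → Fin (n G) → ℕ
deg G v = count (adj G v)

numV : Graph → ℕ
numV G = n G

numE : Graph → ℕ
numE G = countPairs (adj G)

MaxDegLe : Graph → ℕ → Set
MaxDegLe G k = ∀ v → deg G v ≤ k

record Subgraph (G : Graph) : Set where
  field
    S   : Fin (n G) → Bool
    E   : Fin (n G) → Fin (n G) → Bool
    E⊆  : ∀ i j → E i j ≡ true → (adj G i j ≡ true) × (S i ≡ true) × (S j ≡ true)
open Subgraph public

subV : {G : Graph} → Subgraph G → ℕ
subV F = count (S F)

subE : {G : Graph} → Subgraph G → ℕ
subE F = countPairs (E F)

-- mad(G) < 8/3 : every (nonempty) subgraph F has 2|E(F)|/|V(F)| < 8/3,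
-- i.e. (clearing denominators) 6|E(F)| < 8|V(F)|.
MadLt8/3 : Graph → Set
MadLt8/3 G = ∀ (F : Subgraph G) → 0 < subV F → 6 * subE F < 8 * subV F

data Reach (G : Graph) : Fin (n G) → Fin (n G) → Set where
  here : ∀ {u} → Reach G u u
  step : ∀ {u v w} → adj G u v ≡ true → Reach G v w → Reach G u w

Connected : Graph → Set
Connected G = ∀ u v → Reach G u v

-- Injective k-edge-coloring. A coloring assigns c u v to the edge uv
-- (values on non-edges are irrelevant); it must be symmetric on edges.
record InjEdgeColoring (G : Graph) (k : ℕ) : Set where
  field
    col     : Fin (n G) → Fin (n G) → Fin k
    col-sym : ∀ u v → adj G u v ≡ true → col u v ≡ col v u
    dist2   : ∀ u v x y → adj G u v ≡ true → adj G x y ≡ true →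
              u ≢ x → u ≢ y → v ≢ x → v ≢ y →
              (adj G u x ≡ true ⊎ adj G u y ≡ true ⊎ adj G v x ≡ true ⊎ adj G v y ≡ true) →
              col u v ≢ col x y
    triangle : ∀ a b d → adj G a b ≡ true → adj G b d ≡ true → adj G a d ≡ true →
              col a b ≢ col b d

ChiILe : Graph → ℕ → Set
ChiILe G k = InjEdgeColoring G k

record MinimalCounterexample (G : Graph) : Set₁ where
  field
    connected : Connected G
    maxdeg    : MaxDegLe G 4
    mad       : MadLt8/3 G
    notCol    : ¬ ChiILe G 7
    minimal   : ∀ (G' : Graph) → MaxDegLe G' 4 → MadLt8/3 G' →
                numV G' + numE G' < numV G + numE G → ChiILe G' 7

-- H = G minus all vertices of degree 1, represented on the vertex set of G:
-- inH v says v is a vertex of H, adjH is the induced adjacency.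
notOne : ℕ → Bool
notOne 1 = false
notOne _ = true

keepH : (G : Graph) → Fin (n G) → Bool
keepH G v = notOne (deg G v)

inH : (G : Graph) → Fin (n G) → Set
inH G v = keepH G v ≡ true

adjH : (G : Graph) → Fin (n G) → Fin (n G) → Bool
adjH G u v = adj G u v ∧ keepH G u ∧ keepH G v

degH : (G : Graph) → Fin (n G) → ℕ
degH G v = count (adjH G v)

isDeg2ᵇ : (G : Graph) → Fin (n G) → Bool
isDeg2ᵇ G w = keepH G w ∧ (degH G w Data.Nat.≡ᵇ 2)

KVertex : (G : Graph) → ℕ → Fin (n G) → Set
KVertex G k v = inH G v × degH G v ≡ k

n2Nbrs : (G : Graph) → Fin (n G) → ℕ
n2Nbrs G v = count (λ w → adjH G v w ∧ isDeg2ᵇ G w)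

KJVertex : (G : Graph) → ℕ → ℕ → Fin (n G) → Set
KJVertex G k j v = KVertex G k v × n2Nbrs G v ≡ j

Three1Plus : (G : Graph) → Fin (n G) → Set
Three1Plus G v = KJVertex G 3 1 v ×
  Σ (Fin (n G)) (λ w → (adjH G v w ≡ true) × KJVertex G 2 1 w)

Poor : (G : Graph) → Fin (n G) → Set
Poor G v = Three1Plus G v ⊎ KJVertex G 3 2 v

module Submission where

-- Each configuration is reducible.  Delete v₁ (when v₃ is a 2-vertex), or v₁, v₂, the pendant neighbours of v₃ and,
-- for a 3₁⁺-vertex, its 2₁-neighbour a (when v₃ is poor); colour the rest by minimality; then colour the deleted edges
-- greedily, one at a time.  A new edge xy has to avoid the colours of the coloured edges at the neighbours z ≠ y of x
-- and z ≠ x of y, at most Σ (deg z − 1) of them, and pendant neighbours contribute nothing.  Since Δ ≤ 4, ordering the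
-- edges so that 2-vertices and still uncoloured edges keep this count at most 6 leaves one of the 7 colours free at
-- every step, so G would be injectively 7-edge-colourable.

open import Data.Bool using (Bool; true; false; not; _∧_; _∨_; if_then_else_)
open import Data.Bool.Properties
  using (T?; T-≡; ∧-conicalˡ; ∧-conicalʳ; ∧-zeroʳ; ∧-comm; ∨-comm; ∨-identityʳ; ∨-zeroʳ) renaming (_≟_ to _≟ᵇ_)
open import Data.Empty using (⊥; ⊥-elim)
open import Data.Fin using (Fin; zero; suc; toℕ; _≟_)
open import Data.Fin.Properties using (any?; injective⇒≤; toℕ-injective)
open import Data.List using (List; []; _∷_; _++_; map; allFin; length; concatMap; filterᵇ; lookup)
open import Data.List.Properties using (map-cong; map-tabulate; length-++; length-map)
open import Data.List.Membership.Propositional using (_∈_; _∉_)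
open import Data.List.Membership.Propositional.Properties
  using (∈-allFin; ∈-map⁺; ∈-filter⁺; ∈-filter⁻; ∈-concatMap⁺; ∈-++⁺ˡ; ∈-++⁺ʳ; ∈-++⁻)
open import Data.List.Relation.Unary.All using (All; []; _∷_)
import Data.List.Relation.Unary.All as All
open import Data.List.Relation.Unary.All.Properties using (¬Any⇒All¬)
open import Data.List.Relation.Unary.AllPairs using ([]; _∷_)
open import Data.List.Relation.Unary.Any using (here; there)
import Data.List.Relation.Unary.Any as Any
open import Data.List.Relation.Unary.Any.Properties using (lookup-index)
open import Data.List.Relation.Unary.Unique.Propositional using (Unique)
open import Data.Nat using (ℕ; zero; suc; _+_; _*_; _≤_; _<_; _<ᵇ_; z≤n; s≤s)
open import Data.Nat.ListAction using (sum)
open import Data.Nat.Properties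
  using ( ≤-refl; ≤-reflexive; ≤-trans; ≤-antisym; ≤-pred; n≤0⇒n≡0; m≤n⇒m≤1+n; <⇒≱; ≮⇒≥; <-cmp; <⇒<ᵇ; ≡ᵇ⇒≡
        ; +-assoc; +-identityʳ; +-mono-≤; +-monoʳ-≤; +-mono-<-≤; +-monoʳ-<; +-cancelˡ-≤
        ; *-zeroʳ; *-identityʳ; *-distribˡ-+; *-monoʳ-≤; +-commutativeSemigroup; module ≤-Reasoning)
open import Algebra.Properties.CommutativeSemigroup +-commutativeSemigroup using (x∙yz≈y∙xz; interchange)
open import Data.Product using (Σ; ∃; _×_; _,_; proj₁; proj₂)
open import Data.Sum using (_⊎_; inj₁; inj₂; [_,_]′)
open import Defs
open import Function using (_∘_; Injective; Equivalence)
open import Relation.Binary.Definitions using (tri<; tri≈; tri>)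
open import Relation.Binary.PropositionalEquality
open import Relation.Nullary using (¬_; does; yes; no; contradiction)
open import Relation.Nullary.Decidable using (dec-true; dec-false; _×-dec_; ¬?)

infix 7 _≡ᵇ_
infixl 6 _∖_

_≡ᵇ_ : ∀ {m} → Fin m → Fin m → Bool
i ≡ᵇ j = does (i ≟ j)

≡ᵇ-refl : ∀ {m} (i : Fin m) → (i ≡ᵇ i) ≡ true
≡ᵇ-refl i = dec-true (i ≟ i) refl

≢⇒≡ᵇ-false : ∀ {m} {i j : Fin m} → i ≢ j → (i ≡ᵇ j) ≡ false
≢⇒≡ᵇ-false {i = i} {j} = dec-false (i ≟ j)

_∖_ : ∀ {m} → (Fin m → Bool) → Fin m → Fin m → Bool
(p ∖ a) i = p i ∧ not (i ≡ᵇ a)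

∖-intro : ∀ {m} (p : Fin m → Bool) {a i} → p i ≡ true → i ≢ a → (p ∖ a) i ≡ true
∖-intro p pᵢ i≢a rewrite pᵢ | ≢⇒≡ᵇ-false i≢a = refl

∖-≢ : ∀ {m} (p : Fin m → Bool) {a i} → (p ∖ a) i ≡ true → i ≢ a
∖-≢ p {i = i} e refl = contradiction (trans (sym e) (trans (cong (λ b → p i ∧ not b) (≡ᵇ-refl i)) (∧-zeroʳ (p i)))) λ ()

not-true : ∀ {b} → not b ≡ true → b ≡ false
not-true {false} _ = refl

∧-intro : ∀ {a b} → a ≡ true → b ≡ true → a ∧ b ≡ true
∧-intro refl refl = refl

∧-trueˡ : ∀ a {b} → a ∧ b ≡ true → a ≡ true
∧-trueˡ a = ∧-conicalˡ a _

∧-trueʳ : ∀ a {b} → a ∧ b ≡ true → b ≡ true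
∧-trueʳ a = ∧-conicalʳ a _

if-≤ : ∀ b n → (if b then n else 0) ≤ n
if-≤ true  n = ≤-refl
if-≤ false n = z≤n

ifᵇ-mono : ∀ {b c m n} → (b ≡ true → c ≡ true) → (b ≡ true → m ≤ n) →
           (if b then m else 0) ≤ (if c then n else 0)
ifᵇ-mono {false} _   _   = z≤n
ifᵇ-mono {true}  b⇒c m≤n rewrite b⇒c refl = m≤n refl

-- Sums and counts over Fin m

module _ {A : Set} where

  sum-map-mono : {f g : A → ℕ} → (∀ x → f x ≤ g x) → ∀ xs → sum (map f xs) ≤ sum (map g xs)
  sum-map-mono f≤g []       = z≤n
  sum-map-mono f≤g (x ∷ xs) = +-mono-≤ (f≤g x) (sum-map-mono f≤g xs)

  sum-map-+ : (f g : A → ℕ) → ∀ xs → sum (map (λ x → f x + g x) xs) ≡ sum (map f xs) + sum (map g xs)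
  sum-map-+ f g []       = refl
  sum-map-+ f g (x ∷ xs) = trans (cong (f x + g x +_) (sum-map-+ f g xs)) (interchange (f x) (g x) _ _)

  sum-map-*ˡ : ∀ k (f : A → ℕ) xs → sum (map (λ x → k * f x) xs) ≡ k * sum (map f xs)
  sum-map-*ˡ k f []       = sym (*-zeroʳ k)
  sum-map-*ˡ k f (x ∷ xs) = trans (cong (k * f x +_) (sum-map-*ˡ k f xs)) (sym (*-distribˡ-+ k (f x) _))

module _ {m : ℕ} where

  sumFin : (Fin m → ℕ) → ℕ
  sumFin f = sum (map f (allFin m))

  sumWhere : (Fin m → Bool) → (Fin m → ℕ) → ℕ
  sumWhere p g = sumFin (λ i → if p i then g i else 0)

  sumFin-mono : {f g : Fin m → ℕ} → (∀ i → f i ≤ g i) → sumFin f ≤ sumFin g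
  sumFin-mono f≤g = sum-map-mono f≤g (allFin m)

  sumFin-cong : {f g : Fin m → ℕ} → (∀ i → f i ≡ g i) → sumFin f ≡ sumFin g
  sumFin-cong f≗g = cong sum (map-cong f≗g (allFin m))

sumFin-suc : ∀ {m} (f : Fin (suc m) → ℕ) → sumFin f ≡ f zero + sumFin (f ∘ suc)
sumFin-suc f = cong (λ xs → f zero + sum xs) (trans (map-tabulate suc f) (sym (map-tabulate (λ i → i) (f ∘ suc))))

sumFin-pick : ∀ {m} (f : Fin m → ℕ) (a : Fin m) → sumFin f ≡ f a + sumFin (λ i → if i ≡ᵇ a then 0 else f i)
sumFin-pick f zero    = trans (sumFin-suc f) (cong (f zero +_) (sym (sumFin-suc (λ i → if i ≡ᵇ zero then 0 else f i))))
sumFin-pick f (suc a) = begin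
  sumFin f                                ≡⟨ sumFin-suc f ⟩
  f zero + sumFin (f ∘ suc)               ≡⟨ cong (f zero +_) (sumFin-pick (f ∘ suc) a) ⟩
  f zero + (f (suc a) + sumFin others)    ≡⟨ x∙yz≈y∙xz (f zero) (f (suc a)) _ ⟩
  f (suc a) + (f zero + sumFin others)    ≡⟨ cong (f (suc a) +_) (sym (sumFin-suc others′)) ⟩
  f (suc a) + sumFin others′              ∎
  where
  open ≡-Reasoning
  others : Fin _ → ℕ
  others i = if i ≡ᵇ a then 0 else f (suc i)
  others′ : Fin _ → ℕ
  others′ i = if i ≡ᵇ suc a then 0 else f i

module _ {m : ℕ} where

  sumFin-< : {f g : Fin m → ℕ} (a : Fin m) → (∀ i → f i ≤ g i) → f a < g a → sumFin f < sumFin g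
  sumFin-< {f} {g} a f≤g fₐ<gₐ = begin-strict
    sumFin f                                          ≡⟨ sumFin-pick f a ⟩
    f a + sumFin (λ i → if i ≡ᵇ a then 0 else f i)   <⟨ +-mono-<-≤ fₐ<gₐ (sumFin-mono rest) ⟩
    g a + sumFin (λ i → if i ≡ᵇ a then 0 else g i)   ≡⟨ sym (sumFin-pick g a) ⟩
    sumFin g                                          ∎
    where
    open ≤-Reasoning
    rest : ∀ i → (if i ≡ᵇ a then 0 else f i) ≤ (if i ≡ᵇ a then 0 else g i)
    rest i with i ≡ᵇ a
    ... | true  = z≤n
    ... | false = f≤g i

  sumWhere-pick : (p : Fin m → Bool) (g : Fin m → ℕ) (a : Fin m) →
                  sumWhere p g ≡ (if p a then g a else 0) + sumWhere (p ∖ a) g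
  sumWhere-pick p g a = trans (sumFin-pick _ a) (cong (_ +_) (sumFin-cong rest))
    where
    rest : ∀ i → (if i ≡ᵇ a then 0 else (if p i then g i else 0)) ≡ (if (p ∖ a) i then g i else 0)
    rest i with p i | i ≡ᵇ a
    ... | true  | true  = refl
    ... | true  | false = refl
    ... | false | true  = refl
    ... | false | false = refl

  sumWhere-split : (p q : Fin m → Bool) (g : Fin m → ℕ) →
                   sumWhere p g ≡ sumWhere (λ i → p i ∧ q i) g + sumWhere (λ i → p i ∧ not (q i)) g
  sumWhere-split p q g = trans (sumFin-cong pointwise) (sum-map-+ _ _ (allFin m))
    where
    pointwise : ∀ i → (if p i then g i else 0) ≡
                      (if p i ∧ q i then g i else 0) + (if p i ∧ not (q i) then g i else 0)
    pointwise i with p i | q i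
    ... | true  | true  = sym (+-identityʳ (g i))
    ... | true  | false = refl
    ... | false | _     = refl

  sumWhere-mono : {p q : Fin m → Bool} {g h : Fin m → ℕ} →
                  (∀ i → p i ≡ true → q i ≡ true) → (∀ i → p i ≡ true → g i ≤ h i) → sumWhere p g ≤ sumWhere q h
  sumWhere-mono p⊆q g≤h = sumFin-mono (λ i → ifᵇ-mono (p⊆q i) (g≤h i))

  sumWhere-≤-*count : (p : Fin m → Bool) (g : Fin m → ℕ) (k : ℕ) → (∀ i → p i ≡ true → g i ≤ k) →
                      sumWhere p g ≤ k * count p
  sumWhere-≤-*count p g k g≤k = begin
    sumWhere p g                                ≤⟨ sumWhere-mono (λ _ pᵢ → pᵢ) g≤k ⟩
    sumFin (λ i → if p i then k else 0)         ≡⟨ sumFin-cong scale ⟩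
    sumFin (λ i → k * (if p i then 1 else 0))   ≡⟨ sum-map-*ˡ k _ (allFin m) ⟩
    k * count p                                 ∎
    where
    open ≤-Reasoning
    scale : ∀ i → (if p i then k else 0) ≡ k * (if p i then 1 else 0)
    scale i with p i
    ... | true  = sym (*-identityʳ k)
    ... | false = sym (*-zeroʳ k)

  sumWhere-≤-candidates : (p : Fin m → Bool) (g : Fin m → ℕ) (xs : List (Fin m)) →
                          (∀ i → p i ≡ true → i ∈ xs) → sumWhere p g ≤ sum (map g xs)
  sumWhere-≤-candidates p g [] p⊆[] = ≤-reflexive (trans (sumFin-cong none) (zeros (allFin m)))
    where
    none : ∀ i → (if p i then g i else 0) ≡ 0
    none i with p i in pᵢ
    ... | true  with () ← p⊆[] i pᵢ
    ... | false = refl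
    zeros : ∀ xs → sum (map (λ (_ : Fin m) → 0) xs) ≡ 0
    zeros []       = refl
    zeros (_ ∷ xs) = zeros xs
  sumWhere-≤-candidates p g (x ∷ xs) p⊆x∷xs = begin
    sumWhere p g                                    ≡⟨ sumWhere-pick p g x ⟩
    (if p x then g x else 0) + sumWhere (p ∖ x) g   ≤⟨ +-mono-≤ (if-≤ (p x) (g x)) (sumWhere-≤-candidates _ g xs p∖x⊆xs) ⟩
    g x + sum (map g xs)                            ∎
    where
    open ≤-Reasoning
    p∖x⊆xs : ∀ i → (p ∖ x) i ≡ true → i ∈ xs
    p∖x⊆xs i e with p⊆x∷xs i (∧-trueˡ (p i) e)
    ... | here i≡x   = contradiction i≡x (∖-≢ p e)
    ... | there i∈xs = i∈xs

  count-cong : {p q : Fin m → Bool} → (∀ i → p i ≡ q i) → count p ≡ count q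
  count-cong p≗q = sumFin-cong (λ i → cong (if_then 1 else 0) (p≗q i))

  count-mono : {p q : Fin m → Bool} → (∀ i → p i ≡ true → q i ≡ true) → count p ≤ count q
  count-mono p⊆q = sumWhere-mono p⊆q (λ _ _ → ≤-refl)

  count-< : {p q : Fin m → Bool} (a : Fin m) → (∀ i → p i ≡ true → q i ≡ true) → p a ≡ false → q a ≡ true →
            count p < count q
  count-< a p⊆q pₐ qₐ = sumFin-< a (λ i → ifᵇ-mono (p⊆q i) (λ _ → ≤-refl))
    (subst₂ (λ b c → (if b then 1 else 0) < (if c then 1 else 0)) (sym pₐ) (sym qₐ) ≤-refl)

  count-≤-length : (p : Fin m → Bool) (xs : List (Fin m)) → (∀ i → p i ≡ true → i ∈ xs) → count p ≤ length xs
  count-≤-length p xs p⊆xs = ≤-trans (sumWhere-≤-candidates p (λ _ → 1) xs p⊆xs) (≤-reflexive (ones xs))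
    where
    ones : ∀ xs → sum (map (λ (_ : Fin m) → 1) xs) ≡ length xs
    ones []       = refl
    ones (_ ∷ xs) = cong suc (ones xs)

  count-remove : (p : Fin m → Bool) (a : Fin m) → p a ≡ true → count p ≡ suc (count (p ∖ a))
  count-remove p a pₐ = trans (sumWhere-pick p (λ _ → 1) a) (cong (λ b → (if b then 1 else 0) + count (p ∖ a)) pₐ)

  length≤count : (p : Fin m → Bool) {xs : List (Fin m)} → Unique xs → All (λ i → p i ≡ true) xs → length xs ≤ count p
  length≤count p []                        []         = z≤n
  length≤count p {x ∷ xs} (x≢xs ∷ unique) (pₓ ∷ pxs) = begin
    suc (length xs)       ≤⟨ s≤s (length≤count (p ∖ x) unique (All.zipWith p∖x (pxs , x≢xs))) ⟩
    suc (count (p ∖ x))   ≡⟨ sym (count-remove p x pₓ) ⟩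
    count p               ∎
    where
    open ≤-Reasoning
    p∖x : ∀ {i} → p i ≡ true × x ≢ i → (p ∖ x) i ≡ true
    p∖x (pᵢ , x≢i) = ∖-intro p pᵢ (≢-sym x≢i)

  count-exhausted : (p : Fin m → Bool) {xs : List (Fin m)} → count p ≤ length xs → Unique xs →
                    All (λ i → p i ≡ true) xs → ∀ z → p z ≡ true → z ∈ xs
  count-exhausted p {xs} p≤xs unique pxs z p_z with Any.any? (z ≟_) xs
  ... | yes z∈xs = z∈xs
  ... | no  z∉xs = contradiction (length≤count p (¬Any⇒All¬ xs z∉xs ∷ unique) (p_z ∷ pxs)) (<⇒≱ (s≤s p≤xs))

  count-beyond : (p : Fin m → Bool) (xs : List (Fin m)) → length xs < count p → ∃ λ z → p z ≡ true × z ∉ xs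
  count-beyond p xs xs<p with any? (λ z → (p z ≟ᵇ true) ×-dec ¬? (Any.any? (z ≟_) xs))
  ... | yes found = found
  ... | no  none  = contradiction (count-≤-length p xs p⊆xs) (<⇒≱ xs<p)
    where
    p⊆xs : ∀ z → p z ≡ true → z ∈ xs
    p⊆xs z p_z with Any.any? (z ≟_) xs
    ... | yes z∈xs = z∈xs
    ... | no  z∉xs = contradiction (z , p_z , z∉xs) none

sum₃≤ : ∀ {a b c p q} → a ≤ p → b + c ≤ q → a + (b + (c + 0)) ≤ p + q
sum₃≤ {b = b} {c} {q = q} a≤p b+c≤q = +-mono-≤ a≤p (subst (_≤ q) (cong (b +_) (sym (+-identityʳ c))) b+c≤q)

sum₃≤′ : ∀ {a b c p q} → a + b ≤ p → c ≤ q → a + (b + (c + 0)) ≤ p + q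
sum₃≤′ {a} {b} {c} {p} {q} a+b≤p c≤q =
  subst (_≤ p + q) (trans (+-assoc a b c) (cong (λ t → a + (b + t)) (sym (+-identityʳ c)))) (+-mono-≤ a+b≤p c≤q)

module _ {A : Set} where

  length-filterᵇ : (p : A → Bool) → ∀ xs → length (filterᵇ p xs) ≡ sum (map (λ x → if p x then 1 else 0) xs)
  length-filterᵇ p []       = refl
  length-filterᵇ p (x ∷ xs) with p x
  ... | true  = cong suc (length-filterᵇ p xs)
  ... | false = length-filterᵇ p xs

  ∈-filterᵇ⁺ : {p : A → Bool} {x : A} {xs : List A} → x ∈ xs → p x ≡ true → x ∈ filterᵇ p xs
  ∈-filterᵇ⁺ {p} x∈xs pₓ = ∈-filter⁺ (T? ∘ p) x∈xs (Equivalence.from T-≡ pₓ)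

module _ {A B : Set} where

  length-concatMap-filterᵇ : (p : A → Bool) (f : A → List B) → ∀ xs →
                             length (concatMap f (filterᵇ p xs)) ≡ sum (map (λ x → if p x then length (f x) else 0) xs)
  length-concatMap-filterᵇ p f []       = refl
  length-concatMap-filterᵇ p f (x ∷ xs) with p x
  ... | true  = trans (length-++ (f x)) (cong (length (f x) +_) (length-concatMap-filterᵇ p f xs))
  ... | false = length-concatMap-filterᵇ p f xs

-- if every colour occurred in L, sending a colour to its position in L would inject Fin 7 into Fin (length L)
missingColour : (L : List (Fin 7)) → length L < 7 → ∃ λ k → k ∉ L
missingColour L short with any? (λ k → ¬? (Any.any? (k ≟_) L))
... | yes found = found
... | no  none  = contradiction (injective⇒≤ index-injective) (<⇒≱ short)
  where
  every : ∀ k → k ∈ L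
  every k with Any.any? (k ≟_) L
  ... | yes k∈L = k∈L
  ... | no  k∉L = contradiction (k , k∉L) none
  index-injective : Injective _≡_ _≡_ (λ k → Any.index (every k))
  index-injective {i} {j} eq =
    trans (lookup-index (every i)) (trans (cong (lookup L) eq) (sym (lookup-index (every j))))

-- Partial injective edge-colourings and the greedy step

module Colouring (G : Graph) where

  Vertex : Set
  Vertex = Fin (n G)

  infix 4 _∼_
  _∼_ : Vertex → Vertex → Set
  u ∼ v = adj G u v ≡ true

  ∼-sym : ∀ {u v} → u ∼ v → v ∼ u
  ∼-sym {u} {v} u∼v = trans (adj-sym G v u) u∼v

  ∼-irrefl : ∀ {u v} → u ∼ v → u ≢ v
  ∼-irrefl {u} u∼u refl = contradiction (trans (sym u∼u) (adj-irrefl G u)) λ ()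

  Joined : Vertex → Vertex → Vertex → Vertex → Set
  Joined u v x y = u ∼ x ⊎ u ∼ y ⊎ v ∼ x ⊎ v ∼ y

  Joined-sym : ∀ {u v x y} → Joined u v x y → Joined x y u v
  Joined-sym (inj₁ u∼x)               = inj₁ (∼-sym u∼x)
  Joined-sym (inj₂ (inj₁ u∼y))        = inj₂ (inj₂ (inj₁ (∼-sym u∼y)))
  Joined-sym (inj₂ (inj₂ (inj₁ v∼x))) = inj₂ (inj₁ (∼-sym v∼x))
  Joined-sym (inj₂ (inj₂ (inj₂ v∼y))) = inj₂ (inj₂ (inj₂ (∼-sym v∼y)))

  SameEdge : Vertex → Vertex → Vertex → Vertex → Set
  SameEdge x y u v = (u ≡ x × v ≡ y) ⊎ (u ≡ y × v ≡ x)

  neighbourExcept : Vertex → Vertex → Vertex → Bool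
  neighbourExcept x y = adj G x ∖ y

  neighbourExcept-intro : ∀ {x y z} → x ∼ z → z ≢ y → neighbourExcept x y z ≡ true
  neighbourExcept-intro {x} = ∖-intro (adj G x)

  neighbourExcept-∼ : ∀ {x y z} → neighbourExcept x y z ≡ true → x ∼ z
  neighbourExcept-∼ {x} {z = z} = ∧-trueˡ (adj G x z)

  neighbourExcept-≢ : ∀ {x y z} → neighbourExcept x y z ≡ true → z ≢ y
  neighbourExcept-≢ {x} = ∖-≢ (adj G x)

  -- P u v ≡ true marks the pair uv as coloured; a colouring's values on the other pairs are irrelevant
  EdgeSet : Set
  EdgeSet = Vertex → Vertex → Bool

  Colours : Set
  Colours = Vertex → Vertex → Fin 7

  record IsPartialColouring (P : EdgeSet) (c : Colours) : Set where
    field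
      coloured-sym : ∀ u v → P u v ≡ P v u
      colour-sym   : ∀ {u v} → u ∼ v → P u v ≡ true → c u v ≡ c v u
      distance-two : ∀ {u v x y} → u ∼ v → x ∼ y → P u v ≡ true → P x y ≡ true →
                     u ≢ x → u ≢ y → v ≢ x → v ≢ y → Joined u v x y → c u v ≢ c x y
      triangle     : ∀ {a b d} → a ∼ b → b ∼ d → a ∼ d → P a b ≡ true → P b d ≡ true → c a b ≢ c b d

  Colourable : EdgeSet → Set
  Colourable P = Σ Colours (IsPartialColouring P)

  complete : ∀ {P} → Colourable P → (∀ {u v} → u ∼ v → P u v ≡ true) → ChiILe G 7
  complete (c , isPC) all = record
    { col      = c
    ; col-sym  = λ _ _ u∼v → colour-sym u∼v (all u∼v)
    ; dist2    = λ _ _ _ _ u∼v x∼y → distance-two u∼v x∼y (all u∼v) (all x∼y)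
    ; triangle = λ _ _ _ a∼b b∼d a∼d → triangle a∼b b∼d a∼d (all a∼b) (all b∼d)
    }
    where open IsPartialColouring isPC

  isEdge : Vertex → Vertex → EdgeSet
  isEdge x y u v = (u ≡ᵇ x ∧ v ≡ᵇ y) ∨ (u ≡ᵇ y ∧ v ≡ᵇ x)

  isEdge-sym : ∀ x y u v → isEdge x y u v ≡ isEdge x y v u
  isEdge-sym x y u v =
    trans (∨-comm (u ≡ᵇ x ∧ v ≡ᵇ y) (u ≡ᵇ y ∧ v ≡ᵇ x)) (cong₂ _∨_ (∧-comm (u ≡ᵇ y) (v ≡ᵇ x)) (∧-comm (u ≡ᵇ x) (v ≡ᵇ y)))

  isEdge-refl : ∀ x y → isEdge x y x y ≡ true
  isEdge-refl x y rewrite ≡ᵇ-refl x | ≡ᵇ-refl y = refl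

  isEdge-true : ∀ {x y u v} → isEdge x y u v ≡ true → SameEdge x y u v
  isEdge-true {x} {y} {u} {v} e with u ≟ x | v ≟ y | u ≟ y | v ≟ x
  ... | yes u≡x | yes v≡y | _       | _       = inj₁ (u≡x , v≡y)
  ... | _       | _       | yes u≡y | yes v≡x = inj₂ (u≡y , v≡x)
  ... | no _    | _       | no _    | _       with () ← e
  ... | no _    | _       | yes _   | no _    with () ← e
  ... | yes _   | no _    | no _    | _       with () ← e
  ... | yes _   | no _    | yes _   | no _    with () ← e

  isEdge-missˡ : ∀ {s t x y} → s ≢ x → s ≢ y → isEdge s t x y ≡ false
  isEdge-missˡ s≢x s≢y rewrite ≢⇒≡ᵇ-false (≢-sym s≢x) | ≢⇒≡ᵇ-false (≢-sym s≢y) = ∧-zeroʳ _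

  isEdge-missʳ : ∀ {s t x y} → t ≢ x → t ≢ y → isEdge s t x y ≡ false
  isEdge-missʳ {s} {x = x} t≢x t≢y rewrite ≢⇒≡ᵇ-false (≢-sym t≢x) | ≢⇒≡ᵇ-false (≢-sym t≢y) =
    trans (∨-identityʳ _) (∧-zeroʳ (x ≡ᵇ s))

  add : EdgeSet → Vertex → Vertex → EdgeSet
  add P x y u v = P u v ∨ isEdge x y u v

  colouredExcept : EdgeSet → Vertex → Vertex → Vertex → Bool
  colouredExcept P z x b = neighbourExcept z x b ∧ P z b

  colouredAt : EdgeSet → Vertex → Vertex → ℕ
  colouredAt P z x = count (colouredExcept P z x)

  conflictsFrom : EdgeSet → Vertex → Vertex → ℕ
  conflictsFrom P x y = sumWhere (neighbourExcept x y) (λ z → colouredAt P z x)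

  -- bounds (an edge may be counted twice) the number of colours that a new colour for xy must avoid
  conflicts : EdgeSet → Vertex → Vertex → ℕ
  conflicts P x y = conflictsFrom P x y + conflictsFrom P y x

  conflictColoursFrom : Colours → EdgeSet → Vertex → Vertex → List (Fin 7)
  conflictColoursFrom c P x y =
    concatMap (λ z → map (c z) (filterᵇ (colouredExcept P z x) (allFin (n G))))
              (filterᵇ (neighbourExcept x y) (allFin (n G)))

  conflictColours : Colours → EdgeSet → Vertex → Vertex → List (Fin 7)
  conflictColours c P x y = conflictColoursFrom c P x y ++ conflictColoursFrom c P y x

  length-conflictColours : ∀ c P x y → length (conflictColours c P x y) ≡ conflicts P x y
  length-conflictColours c P x y = trans (length-++ (conflictColoursFrom c P x y)) (cong₂ _+_ (from x y) (from y x))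
    where
    from : ∀ x y → length (conflictColoursFrom c P x y) ≡ conflictsFrom P x y
    from x y = trans (length-concatMap-filterᵇ _ _ (allFin (n G))) (sumFin-cong λ z →
      cong (if neighbourExcept x y z then_else 0)
           (trans (length-map (c z) (filterᵇ (colouredExcept P z x) (allFin (n G))))
                  (length-filterᵇ (colouredExcept P z x) (allFin (n G)))))

  conflictColours-sym : ∀ {c P x y k} → k ∈ conflictColours c P y x → k ∈ conflictColours c P x y
  conflictColours-sym {c} {P} {x} {y} k∈ with ∈-++⁻ (conflictColoursFrom c P y x) k∈
  ... | inj₁ k∈yx = ∈-++⁺ʳ (conflictColoursFrom c P x y) k∈yx
  ... | inj₂ k∈xy = ∈-++⁺ˡ k∈xy

  ∈-conflictColoursFrom : ∀ {c P x y s t} → x ∼ s → s ≢ y → s ∼ t → t ≢ x → P s t ≡ true →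
                          c s t ∈ conflictColoursFrom c P x y
  ∈-conflictColoursFrom {c} {P} {x} {y} {s} {t} x∼s s≢y s∼t t≢x Pst = ∈-concatMap⁺ _ (Any.map
    (λ { refl → ∈-map⁺ (c s) (∈-filterᵇ⁺ {p = colouredExcept P s x} (∈-allFin t)
                                                                     (∧-intro (neighbourExcept-intro s∼t t≢x) Pst)) })
    (∈-filterᵇ⁺ {p = neighbourExcept x y} (∈-allFin s) (neighbourExcept-intro x∼s s≢y)))

  module _ {P : EdgeSet} {c : Colours} (isPC : IsPartialColouring P c) where
    open IsPartialColouring isPC

    conflict-at-x : ∀ {x y s t} → x ∼ s → s ≢ y → s ∼ t → t ≢ x → P s t ≡ true → c s t ∈ conflictColours c P x y
    conflict-at-x x∼s s≢y s∼t t≢x Pst = ∈-++⁺ˡ (∈-conflictColoursFrom x∼s s≢y s∼t t≢x Pst)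

    conflict-at-y : ∀ {x y s t} → y ∼ s → s ≢ x → s ∼ t → t ≢ y → P s t ≡ true → c s t ∈ conflictColours c P x y
    conflict-at-y {x} y∼s s≢x s∼t t≢y Pst =
      ∈-++⁺ʳ (conflictColoursFrom c P x _) (∈-conflictColoursFrom y∼s s≢x s∼t t≢y Pst)

    conflict-at-x′ : ∀ {x y s t} → x ∼ t → t ≢ y → s ∼ t → s ≢ x → P s t ≡ true → c s t ∈ conflictColours c P x y
    conflict-at-x′ {s = s} {t} x∼t t≢y s∼t s≢x Pst rewrite colour-sym s∼t Pst =
      conflict-at-x x∼t t≢y (∼-sym s∼t) s≢x (trans (coloured-sym t s) Pst)

    conflict-at-y′ : ∀ {x y s t} → y ∼ t → t ≢ x → s ∼ t → s ≢ y → P s t ≡ true → c s t ∈ conflictColours c P x y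
    conflict-at-y′ {s = s} {t} y∼t t≢x s∼t s≢y Pst rewrite colour-sym s∼t Pst =
      conflict-at-y y∼t t≢x (∼-sym s∼t) s≢y (trans (coloured-sym t s) Pst)

    joined-conflict : ∀ {x y s t} → s ∼ t → P s t ≡ true → x ≢ s → x ≢ t → y ≢ s → y ≢ t →
                      Joined x y s t → c s t ∈ conflictColours c P x y
    joined-conflict s∼t Pst x≢s x≢t y≢s y≢t (inj₁ x∼s)               = conflict-at-x  x∼s (≢-sym y≢s) s∼t (≢-sym x≢t) Pst
    joined-conflict s∼t Pst x≢s x≢t y≢s y≢t (inj₂ (inj₁ x∼t))        = conflict-at-x′ x∼t (≢-sym y≢t) s∼t (≢-sym x≢s) Pst
    joined-conflict s∼t Pst x≢s x≢t y≢s y≢t (inj₂ (inj₂ (inj₁ y∼s))) = conflict-at-y  y∼s (≢-sym x≢s) s∼t (≢-sym y≢t) Pst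
    joined-conflict s∼t Pst x≢s x≢t y≢s y≢t (inj₂ (inj₂ (inj₂ y∼t))) = conflict-at-y′ y∼t (≢-sym x≢t) s∼t (≢-sym y≢s) Pst

    distance-two-conflict : ∀ {x y u v s t} → SameEdge x y u v → s ∼ t → P s t ≡ true →
                            u ≢ s → u ≢ t → v ≢ s → v ≢ t → Joined u v s t → c s t ∈ conflictColours c P x y
    distance-two-conflict (inj₁ (refl , refl)) s∼t Pst u≢s u≢t v≢s v≢t j = joined-conflict s∼t Pst u≢s u≢t v≢s v≢t j
    distance-two-conflict (inj₂ (refl , refl)) s∼t Pst u≢s u≢t v≢s v≢t j =
      conflictColours-sym (joined-conflict s∼t Pst u≢s u≢t v≢s v≢t j)

    triangle-conflict₁ : ∀ {x y a b d} → SameEdge x y a b → a ∼ b → b ∼ d → a ∼ d → P b d ≡ true →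
                         c b d ∈ conflictColours c P x y
    triangle-conflict₁ (inj₁ (refl , refl)) a∼b b∼d a∼d Pbd =
      conflict-at-x′ a∼d (≢-sym (∼-irrefl b∼d)) b∼d (≢-sym (∼-irrefl a∼b)) Pbd
    triangle-conflict₁ (inj₂ (refl , refl)) a∼b b∼d a∼d Pbd =
      conflict-at-y′ a∼d (≢-sym (∼-irrefl b∼d)) b∼d (≢-sym (∼-irrefl a∼b)) Pbd

    triangle-conflict₂ : ∀ {x y a b d} → SameEdge x y b d → a ∼ b → b ∼ d → a ∼ d → P a b ≡ true →
                         c a b ∈ conflictColours c P x y
    triangle-conflict₂ (inj₁ (refl , refl)) a∼b b∼d a∼d Pab =
      conflict-at-y (∼-sym a∼d) (∼-irrefl a∼b) a∼b (∼-irrefl b∼d) Pab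
    triangle-conflict₂ (inj₂ (refl , refl)) a∼b b∼d a∼d Pab =
      conflict-at-x (∼-sym a∼d) (∼-irrefl a∼b) a∼b (∼-irrefl b∼d) Pab

  extend : ∀ {P} → Colourable P → ∀ {x y} → x ∼ y → conflicts P x y ≤ 6 → Colourable (add P x y)
  extend {P} (c , isPC) {x} {y} x∼y bound = c′ , record
    { coloured-sym = λ u v → cong₂ _∨_ (coloured-sym u v) (isEdge-sym x y u v)
    ; colour-sym   = colour-sym′
    ; distance-two = distance-two′
    ; triangle     = triangle′
    }
    where
    open IsPartialColouring isPC

    fresh : ∃ λ k → k ∉ conflictColours c P x y
    fresh = missingColour _ (s≤s (≤-trans (≤-reflexive (length-conflictColours c P x y)) bound))

    c′ : Colours
    c′ u v = if isEdge x y u v then proj₁ fresh else c u v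

    avoids : ∀ {k} → k ∈ conflictColours c P x y → proj₁ fresh ≢ k
    avoids k∈ refl = proj₂ fresh k∈

    old : ∀ {u v} → P u v ∨ false ≡ true → P u v ≡ true
    old {u} {v} = trans (sym (∨-identityʳ (P u v)))

    colour-sym′ : ∀ {u v} → u ∼ v → add P x y u v ≡ true → c′ u v ≡ c′ v u
    colour-sym′ {u} {v} u∼v Puv rewrite isEdge-sym x y v u with isEdge x y u v
    ... | true  = refl
    ... | false = colour-sym u∼v (old Puv)

    distance-two′ : ∀ {u v s t} → u ∼ v → s ∼ t → add P x y u v ≡ true → add P x y s t ≡ true →
                    u ≢ s → u ≢ t → v ≢ s → v ≢ t → Joined u v s t → c′ u v ≢ c′ s t
    distance-two′ {u} {v} {s} {t} u∼v s∼t Puv Pst u≢s u≢t v≢s v≢t j with isEdge x y u v in e₁ | isEdge x y s t in e₂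
    ... | true  | true  = ⊥-elim (disjoint (isEdge-true e₁) (isEdge-true e₂))
      where
      disjoint : SameEdge x y u v → SameEdge x y s t → ⊥
      disjoint (inj₁ (refl , _)) (inj₁ (refl , _)) = u≢s refl
      disjoint (inj₁ (refl , _)) (inj₂ (_ , refl)) = u≢t refl
      disjoint (inj₂ (refl , _)) (inj₁ (_ , refl)) = u≢t refl
      disjoint (inj₂ (refl , _)) (inj₂ (refl , _)) = u≢s refl
    ... | true  | false = avoids (distance-two-conflict isPC (isEdge-true e₁) s∼t (old Pst) u≢s u≢t v≢s v≢t j)
    ... | false | true  = ≢-sym (avoids (distance-two-conflict isPC (isEdge-true e₂) u∼v (old Puv)
                                           (≢-sym u≢s) (≢-sym v≢s) (≢-sym u≢t) (≢-sym v≢t) (Joined-sym j)))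
    ... | false | false = distance-two u∼v s∼t (old Puv) (old Pst) u≢s u≢t v≢s v≢t j

    triangle′ : ∀ {a b d} → a ∼ b → b ∼ d → a ∼ d → add P x y a b ≡ true → add P x y b d ≡ true → c′ a b ≢ c′ b d
    triangle′ {a} {b} {d} a∼b b∼d a∼d Pab Pbd with isEdge x y a b in e₁ | isEdge x y b d in e₂
    ... | true  | true  = ⊥-elim (two-sides (isEdge-true e₁) (isEdge-true e₂))
      where
      two-sides : SameEdge x y a b → SameEdge x y b d → ⊥
      two-sides (inj₁ (refl , refl)) (inj₁ (b≡a , _))  = ∼-irrefl a∼b (sym b≡a)
      two-sides (inj₁ (refl , _))    (inj₂ (_ , refl)) = ∼-irrefl a∼d refl
      two-sides (inj₂ (refl , _))    (inj₁ (_ , refl)) = ∼-irrefl a∼d refl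
      two-sides (inj₂ (refl , refl)) (inj₂ (b≡a , _))  = ∼-irrefl a∼b (sym b≡a)
    ... | true  | false = avoids (triangle-conflict₁ isPC (isEdge-true e₁) a∼b b∼d a∼d (old Pbd))
    ... | false | true  = ≢-sym (avoids (triangle-conflict₂ isPC (isEdge-true e₂) a∼b b∼d a∼d (old Pab)))
    ... | false | false = triangle a∼b b∼d a∼d (old Pab) (old Pbd)

  Edge : Set
  Edge = Vertex × Vertex

  Listed : Vertex → Vertex → List Edge → Set
  Listed u w es = (u , w) ∈ es ⊎ (w , u) ∈ es

  Avoids : Vertex → Vertex → Edge → Set
  Avoids x y (s , t) = isEdge s t x y ≡ false

  deleted : List Vertex → Vertex → Bool
  deleted ds z = does (Any.any? (z ≟_) ds)

  outside : List Vertex → EdgeSet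
  outside ds u v = not (deleted ds u) ∧ not (deleted ds v)

  outside-deletedʳ : ∀ {ds} u {v} → v ∈ ds → outside ds u v ≡ false
  outside-deletedʳ {ds} u {v} v∈ds rewrite dec-true (Any.any? (v ≟_) ds) v∈ds = ∧-zeroʳ (not (deleted ds u))

  deleteVertices : List Vertex → Graph
  deleteVertices ds = record
    { n          = n G
    ; adj        = λ u v → adj G u v ∧ outside ds u v
    ; adj-sym    = λ u v → cong₂ _∧_ (adj-sym G u v) (∧-comm (not (deleted ds u)) (not (deleted ds v)))
    ; adj-irrefl = λ u → cong (_∧ outside ds u u) (adj-irrefl G u)
    }

  -- the edge ij is counted in numE at its smaller end i
  deleteVertices-loses : ∀ {ds i j} → i ∼ j → outside ds i j ≡ false → toℕ i < toℕ j →
                         numE (deleteVertices ds) < numE G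
  deleteVertices-loses {ds} {i} {j} i∼j out i<j =
    sumFin-< i (λ i′ → count-mono (kept i′)) (count-< j (kept i) gone (∧-intro i∼j (Equivalence.to T-≡ (<⇒<ᵇ i<j))))
    where
    kept : ∀ i′ j′ → ((adj G i′ j′ ∧ outside ds i′ j′) ∧ (toℕ i′ <ᵇ toℕ j′)) ≡ true →
                     (adj G i′ j′ ∧ (toℕ i′ <ᵇ toℕ j′)) ≡ true
    kept i′ j′ e = ∧-intro (∧-trueˡ (adj G i′ j′) (∧-trueˡ (adj G i′ j′ ∧ outside ds i′ j′) e))
                           (∧-trueʳ (adj G i′ j′ ∧ outside ds i′ j′) e)
    gone : ((adj G i j ∧ outside ds i j) ∧ (toℕ i <ᵇ toℕ j)) ≡ false
    gone rewrite out | ∧-zeroʳ (adj G i j) = refl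

  deleteVertices-numE< : ∀ {ds a b} → a ∼ b → b ∈ ds → numE (deleteVertices ds) < numE G
  deleteVertices-numE< {ds} {a} {b} a∼b b∈ds with <-cmp (toℕ a) (toℕ b)
  ... | tri< a<b _ _ = deleteVertices-loses {ds} a∼b (outside-deletedʳ a b∈ds) a<b
  ... | tri≈ _ a≡b _ = contradiction (toℕ-injective a≡b) (∼-irrefl a∼b)
  ... | tri> _ _ b<a = deleteVertices-loses {ds} (∼-sym a∼b) outside-ba b<a
    where
    outside-ba : outside ds b a ≡ false
    outside-ba = trans (∧-comm (not (deleted ds b)) (not (deleted ds a))) (outside-deletedʳ a b∈ds)

  colourable-after-deletion : MinimalCounterexample G → ∀ {ds a b} → a ∼ b → b ∈ ds → Colourable (outside ds)
  colourable-after-deletion mc {ds} a∼b b∈ds = InjEdgeColoring.col φ , record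
    { coloured-sym = λ u v → ∧-comm (not (deleted ds u)) (not (deleted ds v))
    ; colour-sym   = λ u∼v out → InjEdgeColoring.col-sym φ _ _ (∧-intro u∼v out)
    ; distance-two = λ u∼v x∼y out₁ out₂ u≢x u≢y v≢x v≢y j →
        InjEdgeColoring.dist2 φ _ _ _ _ (∧-intro u∼v out₁) (∧-intro x∼y out₂) u≢x u≢y v≢x v≢y (joined-kept out₁ out₂ j)
    ; triangle     = λ a∼b b∼d a∼d out₁ out₂ → InjEdgeColoring.triangle φ _ _ _ (∧-intro a∼b out₁) (∧-intro b∼d out₂)
                                                                        (kept a∼d (present₁ out₁) (present₂ out₂))
    }
    where
    open MinimalCounterexample mc
    G∖ds : Graph
    G∖ds = deleteVertices ds

    inG : Subgraph G∖ds → Subgraph G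
    inG F = record { S = S F ; E = E F ; E⊆ = λ i j e → let (ij , rest) = E⊆ F i j e in ∧-trueˡ (adj G i j) ij , rest }

    φ : InjEdgeColoring G∖ds 7
    φ = minimal G∖ds (λ v → ≤-trans (count-mono (λ w → ∧-trueˡ (adj G v w))) (maxdeg v)) (λ F → mad (inG F))
                     (+-monoʳ-< (n G) (deleteVertices-numE< a∼b b∈ds))

    present₁ : ∀ {u v} → outside ds u v ≡ true → not (deleted ds u) ≡ true
    present₁ {u} = ∧-trueˡ (not (deleted ds u))

    present₂ : ∀ {u v} → outside ds u v ≡ true → not (deleted ds v) ≡ true
    present₂ {u} = ∧-trueʳ (not (deleted ds u))

    kept : ∀ {u v} → u ∼ v → not (deleted ds u) ≡ true → not (deleted ds v) ≡ true → adj G∖ds u v ≡ true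
    kept u∼v u∉ v∉ = ∧-intro u∼v (∧-intro u∉ v∉)

    joined-kept : ∀ {u v x y} → outside ds u v ≡ true → outside ds x y ≡ true → Joined u v x y →
                  adj G∖ds u x ≡ true ⊎ adj G∖ds u y ≡ true ⊎ adj G∖ds v x ≡ true ⊎ adj G∖ds v y ≡ true
    joined-kept o₁ o₂ (inj₁ u∼x)               = inj₁ (kept u∼x (present₁ o₁) (present₁ o₂))
    joined-kept o₁ o₂ (inj₂ (inj₁ u∼y))        = inj₂ (inj₁ (kept u∼y (present₁ o₁) (present₂ o₂)))
    joined-kept o₁ o₂ (inj₂ (inj₂ (inj₁ v∼x))) = inj₂ (inj₂ (inj₁ (kept v∼x (present₂ o₁) (present₁ o₂))))
    joined-kept o₁ o₂ (inj₂ (inj₂ (inj₂ v∼y))) = inj₂ (inj₂ (inj₂ (kept v∼y (present₂ o₁) (present₂ o₂))))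

  -- the edges of G ∖ ds together with those of es, which are coloured one at a time, the latest first in the list
  colouredBy : List Vertex → List Edge → EdgeSet
  colouredBy ds []             = outside ds
  colouredBy ds ((x , y) ∷ es) = add (colouredBy ds es) x y

  colouredBy-sym : ∀ ds es u v → colouredBy ds es u v ≡ colouredBy ds es v u
  colouredBy-sym ds []             u v = ∧-comm (not (deleted ds u)) (not (deleted ds v))
  colouredBy-sym ds ((x , y) ∷ es) u v = cong₂ _∨_ (colouredBy-sym ds es u v) (isEdge-sym x y u v)

  colouredBy-outside : ∀ {ds} es {u v} → outside ds u v ≡ true → colouredBy ds es u v ≡ true
  colouredBy-outside []       out = out
  colouredBy-outside (_ ∷ es) out = cong (_∨ _) (colouredBy-outside es out)

  colouredBy-∈ : ∀ {ds es x y} → (x , y) ∈ es → colouredBy ds es x y ≡ true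
  colouredBy-∈ {ds} {(x , y) ∷ es} (here refl) rewrite isEdge-refl x y = ∨-zeroʳ (colouredBy ds es x y)
  colouredBy-∈ (there xy∈es) = cong (_∨ _) (colouredBy-∈ xy∈es)

  colouredBy-listed : ∀ {ds es u w} → Listed u w es → colouredBy ds es u w ≡ true
  colouredBy-listed (inj₁ uw∈es) = colouredBy-∈ uw∈es
  colouredBy-listed {ds} {es} {u} {w} (inj₂ wu∈es) = trans (colouredBy-sym ds es u w) (colouredBy-∈ wu∈es)

  colouredBy-∉ : ∀ {ds} es {x} y → x ∈ ds → All (Avoids x y) es → colouredBy ds es x y ≡ false
  colouredBy-∉ {ds} [] {x} y x∈ds [] rewrite dec-true (Any.any? (x ≟_) ds) x∈ds = refl
  colouredBy-∉ (_ ∷ es) y x∈ds (miss ∷ misses) = cong₂ _∨_ (colouredBy-∉ es y x∈ds misses) miss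

  colouredBy-total : ∀ {ds es} → (∀ {u w} → u ∈ ds → u ∼ w → Listed u w es) →
                     ∀ {u w} → u ∼ w → colouredBy ds es u w ≡ true
  colouredBy-total {ds} {es} covered {u} {w} u∼w with Any.any? (u ≟_) ds in u? | Any.any? (w ≟_) ds in w?
  ... | yes u∈ds | _        = colouredBy-listed (covered u∈ds u∼w)
  ... | no _     | yes w∈ds = trans (colouredBy-sym ds es u w) (colouredBy-listed (covered w∈ds (∼-sym u∼w)))
  ... | no _     | no _     = colouredBy-outside es (cong₂ (λ a b → not (does a) ∧ not (does b)) u? w?)

  extend-≤1 : ∀ {ds es x} ps → length ps ≤ 1 → All (x ∼_) ps → Colourable (colouredBy ds es) →
              (∀ {p} → p ∈ ps → conflicts (colouredBy ds es) x p ≤ 6) → Colourable (colouredBy ds (map (x ,_) ps ++ es))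
  extend-≤1 []          _         _          colourable _     = colourable
  extend-≤1 (p ∷ [])    _         (x∼p ∷ []) colourable bound = extend colourable x∼p (bound (here refl))
  extend-≤1 (_ ∷ _ ∷ _) (s≤s ())

  reducible : MinimalCounterexample G → ∀ {ds es} → Colourable (colouredBy ds es) →
              (∀ {u w} → u ∈ ds → u ∼ w → Listed u w es) → ⊥
  reducible mc colourable covered = MinimalCounterexample.notCol mc (complete colourable (colouredBy-total covered))

module Minimal (G : Graph) (mc : MinimalCounterexample G) where

  open Colouring G
  open MinimalCounterexample mc using (maxdeg)

  neighbourInH pendantNeighbour : Vertex → Vertex → Bool
  neighbourInH x z     = adj G x z ∧ keepH G z
  pendantNeighbour x z = adj G x z ∧ not (keepH G z)

  ∉H⇒deg≡1 : ∀ {z} → keepH G z ≡ false → deg G z ≡ 1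
  ∉H⇒deg≡1 {z} = one (deg G z)
    where
    one : ∀ d → notOne d ≡ false → d ≡ 1
    one 1 _ = refl

  adjH⇒∼ : ∀ {u w} → adjH G u w ≡ true → u ∼ w
  adjH⇒∼ {u} {w} = ∧-trueˡ (adj G u w)

  adjH⇒inHˡ : ∀ {u w} → adjH G u w ≡ true → inH G u
  adjH⇒inHˡ {u} {w} e = ∧-trueˡ (keepH G u) (∧-trueʳ (adj G u w) e)

  adjH⇒inHʳ : ∀ {u w} → adjH G u w ≡ true → inH G w
  adjH⇒inHʳ {u} {w} e = ∧-trueʳ (keepH G u) (∧-trueʳ (adj G u w) e)

  adjH-sym : ∀ {u w} → adjH G u w ≡ true → adjH G w u ≡ true
  adjH-sym e = ∧-intro (∼-sym (adjH⇒∼ e)) (∧-intro (adjH⇒inHʳ e) (adjH⇒inHˡ e))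

  degH-separates : ∀ {x z k l} → degH G x ≡ k → degH G z ≡ l → k ≢ l → x ≢ z
  degH-separates dHx dHz k≢l refl = k≢l (trans (sym dHx) dHz)

  inH≢pendant : ∀ {x p} → inH G x → keepH G p ≡ false → x ≢ p
  inH≢pendant x∈H p∉H refl with () ← trans (sym x∈H) p∉H

  degH≡count : ∀ {x} → inH G x → degH G x ≡ count (neighbourInH x)
  degH≡count {x} x∈H = count-cong (λ z → cong (λ b → adj G x z ∧ b ∧ keepH G z) x∈H)

  deg≡H+pendants : ∀ x → deg G x ≡ count (neighbourInH x) + count (pendantNeighbour x)
  deg≡H+pendants x = sumWhere-split (adj G x) (keepH G) (λ _ → 1)

  degH≤deg : ∀ x → degH G x ≤ deg G x
  degH≤deg x = count-mono (λ w → ∧-trueˡ (adj G x w))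

  isDeg2ᵇ⇒2-vertex : ∀ {z} → isDeg2ᵇ G z ≡ true → KVertex G 2 z
  isDeg2ᵇ⇒2-vertex {z} e = ∧-trueˡ (keepH G z) e , ≡ᵇ⇒≡ (degH G z) 2 (Equivalence.from T-≡ (∧-trueʳ (keepH G z) e))

  neighbours-exhausted : ∀ {x zs} → deg G x ≡ length zs → Unique zs → All (x ∼_) zs → ∀ {w} → x ∼ w → w ∈ zs
  neighbours-exhausted {x} d≡ unique x∼zs {w} = count-exhausted (adj G x) (≤-reflexive d≡) unique x∼zs w

  H-neighbours-exhausted : ∀ {x zs} → degH G x ≡ length zs → Unique zs → All (λ z → adjH G x z ≡ true) zs →
                           ∀ {w} → adjH G x w ≡ true → w ∈ zs
  H-neighbours-exhausted {x} d≡ unique x∼zs {w} = count-exhausted (adjH G x) (≤-reflexive d≡) unique x∼zs w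

  pendant-neighbour-unique : ∀ {p x w} → keepH G p ≡ false → p ∼ x → p ∼ w → w ≡ x
  pendant-neighbour-unique p∉H p∼x p∼w with neighbours-exhausted (∉H⇒deg≡1 p∉H) ([] ∷ []) (p∼x ∷ []) p∼w
  ... | here w≡x = w≡x

  colouredAt≤candidates : ∀ {P z x} bs → (∀ {b} → z ∼ b → b ≢ x → P z b ≡ true → b ∈ bs) →
                          colouredAt P z x ≤ length bs
  colouredAt≤candidates {P} {z} {x} bs ⊆bs = count-≤-length _ bs λ b e →
    let z∼b = ∧-trueˡ (neighbourExcept z x b) e in
    ⊆bs (neighbourExcept-∼ z∼b) (neighbourExcept-≢ z∼b) (∧-trueʳ (neighbourExcept z x b) e)

  colouredAt≤ : ∀ {P z x k} → z ∼ x → deg G z ≤ suc k → colouredAt P z x ≤ k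
  colouredAt≤ {P} {z} {x} {k} z∼x deg≤ = ≤-pred (begin
    suc (colouredAt P z x)              ≤⟨ s≤s (count-mono (λ b → ∧-trueˡ (neighbourExcept z x b))) ⟩
    suc (count (neighbourExcept z x))   ≡⟨ sym (count-remove (adj G z) x z∼x) ⟩
    deg G z                             ≤⟨ deg≤ ⟩
    suc k                               ∎)
    where open ≤-Reasoning

  colouredAt≤3 : ∀ {P z x} → z ∼ x → colouredAt P z x ≤ 3
  colouredAt≤3 {P} {z} z∼x = colouredAt≤ {P} z∼x (maxdeg z)

  conflictsFrom≤H : ∀ P x y →
                    conflictsFrom P x y ≤ sumWhere (λ z → neighbourExcept x y z ∧ keepH G z) (λ z → colouredAt P z x)
  conflictsFrom≤H P x y = begin
    conflictsFrom P x y                           ≡⟨ sumWhere-split (neighbourExcept x y) (keepH G) _ ⟩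
    sumWhere H-part _ + sumWhere pendant-part _   ≤⟨ +-monoʳ-≤ _ (sumWhere-≤-*count pendant-part _ 0 pendant-zero) ⟩
    sumWhere H-part _ + 0                         ≡⟨ +-identityʳ _ ⟩
    sumWhere H-part _                             ∎
    where
    open ≤-Reasoning
    H-part pendant-part : Vertex → Bool
    H-part z       = neighbourExcept x y z ∧ keepH G z
    pendant-part z = neighbourExcept x y z ∧ not (keepH G z)
    pendant-zero : ∀ z → pendant-part z ≡ true → colouredAt P z x ≤ 0
    pendant-zero z e = colouredAt≤ {P} (∼-sym (neighbourExcept-∼ (∧-trueˡ (neighbourExcept x y z) e)))
                                   (≤-reflexive (∉H⇒deg≡1 (not-true (∧-trueʳ (neighbourExcept x y z) e))))

  conflictsFrom≤3*H : ∀ P x y → conflictsFrom P x y ≤ 3 * count (λ z → neighbourExcept x y z ∧ keepH G z)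
  conflictsFrom≤3*H P x y = ≤-trans (conflictsFrom≤H P x y) (sumWhere-≤-*count _ (λ z → colouredAt P z x) 3
    (λ z e → colouredAt≤3 {P} (∼-sym (neighbourExcept-∼ (∧-trueˡ (neighbourExcept x y z) e)))))

  conflictsFrom≤candidates : ∀ {P x y} zs → (∀ {z} → x ∼ z → z ≢ y → inH G z → z ∈ zs) →
                             conflictsFrom P x y ≤ sum (map (λ z → colouredAt P z x) zs)
  conflictsFrom≤candidates {P} {x} {y} zs ⊆zs = ≤-trans (conflictsFrom≤H P x y) (sumWhere-≤-candidates _ _ zs λ z e →
    let x∼z = ∧-trueˡ (neighbourExcept x y z) e in
    ⊆zs (neighbourExcept-∼ x∼z) (neighbourExcept-≢ x∼z) (∧-trueʳ (neighbourExcept x y z) e))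

  conflictsFrom≤ : ∀ {P x y k} → x ∼ y → deg G x ≤ suc k → conflictsFrom P x y ≤ 3 * k
  conflictsFrom≤ {P} {x} {y} {k} x∼y deg≤ = begin
    conflictsFrom P x y               ≤⟨ sumWhere-≤-*count (neighbourExcept x y) (λ z → colouredAt P z x) 3
                                                            (λ z e → colouredAt≤3 {P} (∼-sym (neighbourExcept-∼ e))) ⟩
    3 * count (neighbourExcept x y)   ≤⟨ *-monoʳ-≤ 3 (≤-pred (≤-trans (≤-reflexive (sym remove-y)) deg≤)) ⟩
    3 * k                             ∎
    where
    open ≤-Reasoning
    remove-y : deg G x ≡ suc (count (neighbourExcept x y))
    remove-y = count-remove (adj G x) y x∼y

  conflicts-safe : ∀ {P x y} → x ∼ y → deg G x ≤ 2 → deg G y ≤ 2 → conflicts P x y ≤ 6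
  conflicts-safe x∼y dx dy = +-mono-≤ (conflictsFrom≤ x∼y dx) (conflictsFrom≤ (∼-sym x∼y) dy)

  2-vertex-pendant-free : ∀ {x p} → inH G x → degH G x ≡ 2 → x ∼ p → keepH G p ≡ false → ⊥
  2-vertex-pendant-free {x} {p} x∈H dH x∼p p∉H =
    reducible mc (extend (colourable-after-deletion mc {p ∷ []} x∼p (here refl)) x∼p bound) covered
    where
    H-neighbours≤2 : count (λ z → neighbourExcept x p z ∧ keepH G z) ≤ 2
    H-neighbours≤2 = ≤-trans (count-mono (λ z e → ∧-intro (neighbourExcept-∼ (∧-trueˡ (neighbourExcept x p z) e))
                                                          (∧-trueʳ (neighbourExcept x p z) e)))
                             (≤-reflexive (trans (sym (degH≡count x∈H)) dH))
    bound : conflicts (outside (p ∷ [])) x p ≤ 6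
    bound = +-mono-≤ (≤-trans (conflictsFrom≤3*H _ x p) (*-monoʳ-≤ 3 H-neighbours≤2))
                     (conflictsFrom≤ (∼-sym x∼p) (≤-reflexive (∉H⇒deg≡1 p∉H)))
    covered : ∀ {u w} → u ∈ p ∷ [] → u ∼ w → Listed u w ((x , p) ∷ [])
    covered (here refl) p∼w = inj₂ (here (cong (_, p) (pendant-neighbour-unique p∉H (∼-sym x∼p) p∼w)))

  2-vertex⇒deg≡2 : ∀ {x} → KVertex G 2 x → deg G x ≡ 2
  2-vertex⇒deg≡2 {x} (x∈H , dH) = begin
    deg G x                                               ≡⟨ deg≡H+pendants x ⟩
    count (neighbourInH x) + count (pendantNeighbour x)   ≡⟨ cong₂ _+_ (trans (sym (degH≡count x∈H)) dH) no-pendants ⟩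
    2                                                     ∎
    where
    open ≡-Reasoning
    no-pendants : count (pendantNeighbour x) ≡ 0
    no-pendants = n≤0⇒n≡0 (≮⇒≥ λ 0<c → let (p , e , _) = count-beyond (pendantNeighbour x) [] 0<c in
      2-vertex-pendant-free x∈H dH (∧-trueˡ (adj G x p) e) (not-true (∧-trueʳ (adj G x p) e)))

  -- x is a 2₁-vertex of H next to the vertex y, which is not a 2-vertex; the 2-vertex next to x is its partner
  record TwoOneVertex (x y : Vertex) : Set where
    field
      partner      : Vertex
      x∼partner    : x ∼ partner
      partner≢y    : partner ≢ y
      deg-x        : deg G x ≡ 2
      deg-partner  : deg G partner ≡ 2
      degH-partner : degH G partner ≡ 2
      neighbours   : ∀ {z} → x ∼ z → z ≡ y ⊎ z ≡ partner

  twoOneVertex : ∀ {x y} → KJVertex G 2 1 x → adjH G x y ≡ true → degH G y ≢ 2 → TwoOneVertex x y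
  twoOneVertex {x} {y} (x-2-vertex , one) x∼ₕy dHy≢2 = record
    { partner      = u
    ; x∼partner    = x∼u
    ; partner≢y    = u≢y
    ; deg-x        = deg-x
    ; deg-partner  = 2-vertex⇒deg≡2 u-2-vertex
    ; degH-partner = proj₂ u-2-vertex
    ; neighbours   = neighbour ∘ neighbours-exhausted deg-x ((≢-sym u≢y ∷ []) ∷ [] ∷ []) (adjH⇒∼ x∼ₕy ∷ x∼u ∷ [])
    }
    where
    found : ∃ λ u → (adjH G x u ∧ isDeg2ᵇ G u) ≡ true × u ∉ []
    found = count-beyond (λ w → adjH G x w ∧ isDeg2ᵇ G w) [] (subst (0 <_) (sym one) (s≤s z≤n))
    u : Vertex
    u = proj₁ found
    x∼u : x ∼ u
    x∼u = adjH⇒∼ (∧-trueˡ (adjH G x u) (proj₁ (proj₂ found)))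
    u-2-vertex : KVertex G 2 u
    u-2-vertex = isDeg2ᵇ⇒2-vertex (∧-trueʳ (adjH G x u) (proj₁ (proj₂ found)))
    u≢y : u ≢ y
    u≢y = degH-separates (proj₂ u-2-vertex) refl (λ 2≡dHy → dHy≢2 (sym 2≡dHy))
    deg-x : deg G x ≡ 2
    deg-x = 2-vertex⇒deg≡2 x-2-vertex
    neighbour : ∀ {z} → z ∈ y ∷ u ∷ [] → z ≡ y ⊎ z ≡ u
    neighbour (here z≡y)         = inj₁ z≡y
    neighbour (there (here z≡u)) = inj₂ z≡u

  module _ {x y} (T : TwoOneVertex x y) where
    open TwoOneVertex T

    twoOne-conflictsFrom≤1 : ∀ {P} → conflictsFrom P x y ≤ 1
    twoOne-conflictsFrom≤1 {P} = ≤-trans (conflictsFrom≤candidates (partner ∷ []) only-partner)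
      (≤-trans (≤-reflexive (+-identityʳ _)) (colouredAt≤ {P} (∼-sym x∼partner) (≤-reflexive deg-partner)))
      where
      only-partner : ∀ {z} → x ∼ z → z ≢ y → inH G z → z ∈ partner ∷ []
      only-partner x∼z z≢y _ with neighbours x∼z
      ... | inj₁ z≡y       = contradiction z≡y z≢y
      ... | inj₂ z≡partner = here z≡partner

    twoOne-uncoloured : ∀ {P} → P x partner ≡ false → colouredAt P x y ≡ 0
    twoOne-uncoloured {P} Pxu = n≤0⇒n≡0 (colouredAt≤candidates {P} [] none)
      where
      none : ∀ {b} → x ∼ b → b ≢ y → P x b ≡ true → b ∈ []
      none x∼b b≢y Pxb with neighbours x∼b
      ... | inj₁ b≡y  = contradiction b≡y b≢y
      ... | inj₂ refl with () ← trans (sym Pxb) Pxu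

    twoOne-safe : ∀ {P} → conflicts P x partner ≤ 6
    twoOne-safe = conflicts-safe x∼partner (≤-reflexive deg-x) (≤-reflexive deg-partner)

    twoOne-covered : ∀ {es} → (y , x) ∈ es → (x , partner) ∈ es → ∀ {w} → x ∼ w → Listed x w es
    twoOne-covered yx∈es xu∈es x∼w with neighbours x∼w
    ... | inj₁ refl = inj₂ yx∈es
    ... | inj₂ refl = inj₁ xu∈es

  conflicts-towards-2₁ : ∀ {P x y b c d} → TwoOneVertex y x → (∀ {z} → x ∼ z → z ≢ y → z ∈ b ∷ c ∷ d ∷ []) → x ∼ d →
                         colouredAt P b x + colouredAt P c x ≤ 2 → conflicts P x y ≤ 6
  conflicts-towards-2₁ {P} {x} {y} {b} {c} {d} T others x∼d b+c≤2 =
    +-mono-≤ (≤-trans (conflictsFrom≤candidates (b ∷ c ∷ d ∷ []) (λ x∼z z≢y _ → others x∼z z≢y))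
                      (sum₃≤′ {b = colouredAt P c x} b+c≤2 (colouredAt≤3 {P} (∼-sym x∼d))))
             (twoOne-conflictsFrom≤1 T)

  module ThreeVertex {x y} (x-3-vertex : KVertex G 3 x) (x∼ₕy : adjH G x y ≡ true) where

    pendants : List Vertex
    pendants = filterᵇ (pendantNeighbour x) (allFin (n G))

    pendants⁻ : ∀ {p} → p ∈ pendants → x ∼ p × keepH G p ≡ false
    pendants⁻ {p} p∈ = ∧-trueˡ (adj G x p) e , not-true (∧-trueʳ (adj G x p) e)
      where e = Equivalence.to T-≡ (proj₂ (∈-filter⁻ (T? ∘ pendantNeighbour x) {xs = allFin (n G)} p∈))

    pendants⁺ : ∀ {p} → x ∼ p → keepH G p ≡ false → p ∈ pendants
    pendants⁺ x∼p p∉H = ∈-filterᵇ⁺ (∈-allFin _) (∧-intro x∼p (cong not p∉H))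

    length-pendants : length pendants ≤ 1
    length-pendants = +-cancelˡ-≤ 3 _ _ (begin
      3 + length pendants                                 ≡⟨ cong₂ _+_ (sym H-neighbours) length-filtered ⟩
      count (neighbourInH x) + count (pendantNeighbour x) ≡⟨ sym (deg≡H+pendants x) ⟩
      deg G x                                             ≤⟨ maxdeg x ⟩
      4                                                   ∎)
      where
      open ≤-Reasoning
      H-neighbours : count (neighbourInH x) ≡ 3
      H-neighbours = trans (sym (degH≡count (proj₁ x-3-vertex))) (proj₂ x-3-vertex)
      length-filtered : length pendants ≡ count (pendantNeighbour x)
      length-filtered = length-filterᵇ (pendantNeighbour x) (allFin (n G))

    colour-pendants : ∀ {ds es} → Colourable (colouredBy ds es) →
                      (∀ {p} → p ∈ pendants → conflicts (colouredBy ds es) x p ≤ 6) →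
                      Colourable (colouredBy ds (map (x ,_) pendants ++ es))
    colour-pendants = extend-≤1 pendants length-pendants (All.tabulate (proj₁ ∘ pendants⁻))

    pendant-covered : ∀ {p es} → p ∈ pendants → (x , p) ∈ es → ∀ {w} → p ∼ w → Listed p w es
    pendant-covered p∈ xp∈es p∼w with pendants⁻ p∈
    ... | x∼p , p∉H rewrite pendant-neighbour-unique p∉H (∼-sym x∼p) p∼w = inj₂ xp∈es

    H-neighbours-beyond : ∀ {a} → adjH G x a ≡ true → a ≢ y →
                          ∃ λ w → adjH G x w ≡ true × (∀ {z} → adjH G x z ≡ true → z ∈ y ∷ a ∷ w ∷ [])
    H-neighbours-beyond {a} x∼ₕa a≢y
      with count-beyond (adjH G x) (y ∷ a ∷ []) (subst (2 <_) (sym (proj₂ x-3-vertex)) ≤-refl)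
    ... | w , x∼ₕw , w∉ = w , x∼ₕw , H-neighbours-exhausted (proj₂ x-3-vertex) unique (x∼ₕy ∷ x∼ₕa ∷ x∼ₕw ∷ [])
      where
      unique : Unique (y ∷ a ∷ w ∷ [])
      unique = (≢-sym a≢y ∷ (λ y≡w → w∉ (here (sym y≡w))) ∷ []) ∷ ((λ a≡w → w∉ (there (here (sym a≡w)))) ∷ []) ∷ [] ∷ []

    module Neighbours {a w} (H-neighbours : ∀ {z} → adjH G x z ≡ true → z ∈ y ∷ a ∷ w ∷ []) where

      neighbour-in-H : ∀ {z} → x ∼ z → inH G z → z ∈ y ∷ a ∷ w ∷ []
      neighbour-in-H x∼z z∈H = H-neighbours (∧-intro x∼z (∧-intro (proj₁ x-3-vertex) z∈H))

      colouredAt≤2 : ∀ {P} → (∀ {p} → p ∈ pendants → P x p ≡ false) → colouredAt P x y ≤ 2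
      colouredAt≤2 {P} pendants-uncoloured = colouredAt≤candidates {P} (a ∷ w ∷ []) candidate
        where
        candidate : ∀ {b} → x ∼ b → b ≢ y → P x b ≡ true → b ∈ a ∷ w ∷ []
        candidate {b} x∼b b≢y Pxb with keepH G b in b∈H
        ... | false with () ← trans (sym Pxb) (pendants-uncoloured (pendants⁺ x∼b b∈H))
        ... | true with neighbour-in-H x∼b b∈H
        ...   | here b≡y    = contradiction b≡y b≢y
        ...   | there b∈a∷w = b∈a∷w

      pendant-conflicts : ∀ {P p} → p ∈ pendants → colouredAt P a x + colouredAt P w x ≤ 3 → conflicts P x p ≤ 6
      pendant-conflicts {P} {p} p∈ a+w≤3 =
        +-mono-≤ from-x (conflictsFrom≤ (∼-sym (proj₁ (pendants⁻ p∈))) (≤-reflexive (∉H⇒deg≡1 (proj₂ (pendants⁻ p∈)))))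
        where
        from-x : conflictsFrom P x p ≤ 6
        from-x = ≤-trans (conflictsFrom≤candidates (y ∷ a ∷ w ∷ []) (λ x∼z _ z∈H → neighbour-in-H x∼z z∈H))
                         (sum₃≤ {b = colouredAt P a x} (colouredAt≤3 {P} (∼-sym (adjH⇒∼ x∼ₕy))) a+w≤3)

    other-2-vertices : n2Nbrs G x ≡ 2 → degH G y ≢ 2 →
                       ∃ λ a → ∃ λ w → adjH G x a ≡ true × adjH G x w ≡ true × deg G a ≡ 2 × deg G w ≡ 2 ×
                                       (∀ {z} → adjH G x z ≡ true → z ∈ y ∷ a ∷ w ∷ [])
    other-2-vertices two dHy≢2
      with count-beyond (adjH G x) (y ∷ []) (subst (1 <_) (sym (proj₂ x-3-vertex)) (s≤s (s≤s z≤n)))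
    ... | a , x∼ₕa , a∉ with H-neighbours-beyond x∼ₕa (λ a≡y → a∉ (here a≡y))
    ...   | w , x∼ₕw , H-neighbours = a , w , x∼ₕa , x∼ₕw ,
      2-vertex⇒deg≡2 (2-vertex a w (λ z∈ → z∈)) , 2-vertex⇒deg≡2 (2-vertex w a swap) , H-neighbours
      where
      two-neighbour : Vertex → Bool
      two-neighbour z = adjH G x z ∧ isDeg2ᵇ G z
      two-neighbours : ∀ {z} → two-neighbour z ≡ true → z ∈ a ∷ w ∷ []
      two-neighbours {z} e with H-neighbours (∧-trueˡ (adjH G x z) e)
      ... | here refl   = contradiction (proj₂ (isDeg2ᵇ⇒2-vertex (∧-trueʳ (adjH G x z) e))) dHy≢2
      ... | there z∈a∷w = z∈a∷w
      swap : ∀ {z} → z ∈ a ∷ w ∷ [] → z ∈ w ∷ a ∷ []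
      swap (here z≡a)         = there (here z≡a)
      swap (there (here z≡w)) = here z≡w
      2-vertex : ∀ b c → (∀ {z} → z ∈ a ∷ w ∷ [] → z ∈ b ∷ c ∷ []) → KVertex G 2 b
      2-vertex b c ⊆b∷c with isDeg2ᵇ G b in b-2
      ... | true  = isDeg2ᵇ⇒2-vertex b-2
      ... | false = contradiction (count-≤-length two-neighbour (c ∷ []) only-c) (<⇒≱ (subst (1 <_) (sym two) ≤-refl))
        where
        only-c : ∀ z → two-neighbour z ≡ true → z ∈ c ∷ []
        only-c z e with ⊆b∷c (two-neighbours e)
        ... | here refl with () ← trans (sym (∧-trueʳ (adjH G x z) e)) b-2
        ... | there z∈c = z∈c

  -- The configuration around v

  module FourVertex {v v₁ v₂ v₃ v₄ : Vertex} (v-4-vertex : KVertex G 4 v)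
    (v∼ₕv₁ : adjH G v v₁ ≡ true) (v∼ₕv₂ : adjH G v v₂ ≡ true) (v∼ₕv₃ : adjH G v v₃ ≡ true) (v∼ₕv₄ : adjH G v v₄ ≡ true)
    (v₁≢v₂ : v₁ ≢ v₂) (v₁≢v₃ : v₁ ≢ v₃) (v₁≢v₄ : v₁ ≢ v₄) (v₂≢v₃ : v₂ ≢ v₃) (v₂≢v₄ : v₂ ≢ v₄) (v₃≢v₄ : v₃ ≢ v₄)
    (v₁-2₁ : KJVertex G 2 1 v₁) (v₂-2₁ : KJVertex G 2 1 v₂) where

    v∼v₁ : v ∼ v₁
    v∼v₁ = adjH⇒∼ v∼ₕv₁

    v∼v₂ : v ∼ v₂
    v∼v₂ = adjH⇒∼ v∼ₕv₂

    v∼v₃ : v ∼ v₃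
    v∼v₃ = adjH⇒∼ v∼ₕv₃

    degH-v≢2 : degH G v ≢ 2
    degH-v≢2 dHv≡2 with () ← trans (sym (proj₂ v-4-vertex)) dHv≡2

    v≢2-vertex : ∀ {z} → degH G z ≡ 2 → v ≢ z
    v≢2-vertex dHz = degH-separates (proj₂ v-4-vertex) dHz λ ()

    v-neighbours : ∀ {z} → v ∼ z → z ∈ v₁ ∷ v₂ ∷ v₃ ∷ v₄ ∷ []
    v-neighbours = neighbours-exhausted deg-v
      ((v₁≢v₂ ∷ v₁≢v₃ ∷ v₁≢v₄ ∷ []) ∷ (v₂≢v₃ ∷ v₂≢v₄ ∷ []) ∷ (v₃≢v₄ ∷ []) ∷ [] ∷ [])
      (v∼v₁ ∷ v∼v₂ ∷ v∼v₃ ∷ adjH⇒∼ v∼ₕv₄ ∷ [])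
      where
      deg-v : deg G v ≡ 4
      deg-v = ≤-antisym (maxdeg v) (≤-trans (≤-reflexive (sym (proj₂ v-4-vertex))) (degH≤deg v))

    T₁ : TwoOneVertex v₁ v
    T₁ = twoOneVertex v₁-2₁ (adjH-sym v∼ₕv₁) degH-v≢2

    T₂ : TwoOneVertex v₂ v
    T₂ = twoOneVertex v₂-2₁ (adjH-sym v∼ₕv₂) degH-v≢2

    open TwoOneVertex T₁ using () renaming (partner to u₁; x∼partner to v₁∼u₁; degH-partner to degH-u₁)
    open TwoOneVertex T₂ using () renaming (partner to u₂; x∼partner to v₂∼u₂; degH-partner to degH-u₂)

    conflicts-vv₁ : ∀ {P} → colouredAt P v₂ v + colouredAt P v₃ v ≤ 2 → conflicts P v v₁ ≤ 6
    conflicts-vv₁ = conflicts-towards-2₁ T₁ others (adjH⇒∼ v∼ₕv₄)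
      where
      others : ∀ {z} → v ∼ z → z ≢ v₁ → z ∈ v₂ ∷ v₃ ∷ v₄ ∷ []
      others v∼z z≢v₁ with v-neighbours v∼z
      ... | here z≡v₁ = contradiction z≡v₁ z≢v₁
      ... | there z∈  = z∈

    conflicts-vv₂ : ∀ {P} → colouredAt P v₁ v + colouredAt P v₃ v ≤ 2 → conflicts P v v₂ ≤ 6
    conflicts-vv₂ = conflicts-towards-2₁ T₂ others (adjH⇒∼ v∼ₕv₄)
      where
      others : ∀ {z} → v ∼ z → z ≢ v₂ → z ∈ v₁ ∷ v₃ ∷ v₄ ∷ []
      others v∼z z≢v₂ with v-neighbours v∼z
      ... | here z≡v₁         = here z≡v₁
      ... | there (here z≡v₂) = contradiction z≡v₂ z≢v₂
      ... | there (there z∈)  = there z∈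

    v₃-not-2-vertex : ¬ KVertex G 2 v₃
    v₃-not-2-vertex v₃-2-vertex = reducible mc colourable covered
      where
      ds : List Vertex
      ds = v₁ ∷ []

      es : List Edge
      es = (v₁ , u₁) ∷ (v , v₁) ∷ []

      bound : conflicts (outside ds) v v₁ ≤ 6
      bound = conflicts-vv₁ {outside ds}
        (+-mono-≤ (colouredAt≤ {outside ds} (∼-sym v∼v₂) (≤-reflexive (TwoOneVertex.deg-x T₂)))
                  (colouredAt≤ {outside ds} (∼-sym v∼v₃) (≤-reflexive (2-vertex⇒deg≡2 v₃-2-vertex))))

      colourable : Colourable (colouredBy ds es)
      colourable =
        extend (extend (colourable-after-deletion mc {ds} v∼v₁ (here refl)) v∼v₁ bound) v₁∼u₁ (twoOne-safe T₁)

      covered : ∀ {u w} → u ∈ ds → u ∼ w → Listed u w es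
      covered (here refl) = twoOne-covered T₁ (there (here refl)) (here refl)

    -- When v₃ is poor, vv₁ and vv₂ are coloured while the pendant edges at v₃ and v₁u₁, v₂u₂ (and aa′) are not yet.

    module ThreeTwo (v₃-3-vertex : KVertex G 3 v₃) {a w} (v₃∼ₕa : adjH G v₃ a ≡ true) (v₃∼ₕw : adjH G v₃ w ≡ true)
                    (deg-a : deg G a ≡ 2) (deg-w : deg G w ≡ 2)
                    (H-neighbours : ∀ {z} → adjH G v₃ z ≡ true → z ∈ v ∷ a ∷ w ∷ []) where

      open ThreeVertex v₃-3-vertex (adjH-sym v∼ₕv₃)
      open Neighbours H-neighbours

      ds : List Vertex
      ds = v₁ ∷ v₂ ∷ pendants

      coloured : List Edge → EdgeSet
      coloured = colouredBy ds

      es₁ es₂ es : List Edge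
      es₁ = (v , v₁) ∷ []
      es₂ = (v , v₂) ∷ es₁
      es  = (v₂ , u₂) ∷ (v₁ , u₁) ∷ map (v₃ ,_) pendants ++ es₂

      pendant-edges-uncoloured : ∀ es′ → (∀ {p} → p ∈ pendants → All (Avoids p v₃) es′) →
                                 ∀ {p} → p ∈ pendants → coloured es′ v₃ p ≡ false
      pendant-edges-uncoloured es′ avoid {p} p∈ =
        trans (colouredBy-sym ds es′ v₃ p) (colouredBy-∉ {ds} es′ v₃ (there (there p∈)) (avoid p∈))

      v≢pendant : ∀ {p} → p ∈ pendants → v ≢ p
      v≢pendant p∈ = inH≢pendant (proj₁ v-4-vertex) (proj₂ (pendants⁻ p∈))

      bound₁ : conflicts (coloured []) v v₁ ≤ 6
      bound₁ = conflicts-vv₁ {coloured []}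
        (+-mono-≤ (≤-reflexive (twoOne-uncoloured T₂ {coloured []} (colouredBy-∉ {ds} [] u₂ (there (here refl)) [])))
                  (colouredAt≤2 {coloured []} (pendant-edges-uncoloured [] λ _ → [])))

      bound₂ : conflicts (coloured es₁) v v₂ ≤ 6
      bound₂ = conflicts-vv₂ {coloured es₁}
        (+-mono-≤ (≤-reflexive (twoOne-uncoloured T₁ {coloured es₁} (colouredBy-∉ {ds} es₁ u₁ (here refl) v₁u₁-avoids)))
                  (colouredAt≤2 {coloured es₁}
                    (pendant-edges-uncoloured es₁ λ p∈ → isEdge-missˡ (v≢pendant p∈) (∼-irrefl v∼v₃) ∷ [])))
        where
        v₁u₁-avoids : All (Avoids v₁ u₁) es₁
        v₁u₁-avoids = isEdge-missˡ (∼-irrefl v∼v₁) (v≢2-vertex degH-u₁) ∷ []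

      bound-pendant : ∀ {p} → p ∈ pendants → conflicts (coloured es₂) v₃ p ≤ 6
      bound-pendant p∈ = pendant-conflicts {coloured es₂} p∈ (m≤n⇒m≤1+n
        (+-mono-≤ (colouredAt≤ {coloured es₂} (∼-sym (adjH⇒∼ v₃∼ₕa)) (≤-reflexive deg-a))
                  (colouredAt≤ {coloured es₂} (∼-sym (adjH⇒∼ v₃∼ₕw)) (≤-reflexive deg-w))))

      colourable : Colourable (coloured es)
      colourable = extend (extend (colour-pendants stage₂ bound-pendant) v₁∼u₁ (twoOne-safe T₁)) v₂∼u₂ (twoOne-safe T₂)
        where
        stage₂ : Colourable (coloured es₂)
        stage₂ = extend (extend (colourable-after-deletion mc {ds} v∼v₁ (here refl)) v∼v₁ bound₁) v∼v₂ bound₂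

      earlier : ∀ {e} → e ∈ es₂ → e ∈ es
      earlier e∈ = there (there (∈-++⁺ʳ (map (v₃ ,_) pendants) e∈))

      covered : ∀ {u w} → u ∈ ds → u ∼ w → Listed u w es
      covered (here refl)         = twoOne-covered T₁ (earlier (there (here refl))) (there (here refl))
      covered (there (here refl)) = twoOne-covered T₂ (earlier (here refl)) (here refl)
      covered (there (there p∈))  = pendant-covered p∈ (there (there (∈-++⁺ˡ (∈-map⁺ (v₃ ,_) p∈))))

      impossible : ⊥
      impossible = reducible mc colourable covered

    v₃-not-3₂ : ¬ KJVertex G 3 2 v₃
    v₃-not-3₂ (v₃-3-vertex , two) =
      let (a , w , v₃∼ₕa , v₃∼ₕw , deg-a , deg-w , H-neighbours) =
            ThreeVertex.other-2-vertices v₃-3-vertex (adjH-sym v∼ₕv₃) two degH-v≢2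
      in ThreeTwo.impossible v₃-3-vertex v₃∼ₕa v₃∼ₕw deg-a deg-w H-neighbours

    module ThreeOnePlus (v₃-3-vertex : KVertex G 3 v₃) {a w} (v₃∼ₕa : adjH G v₃ a ≡ true) (a-2₁ : KJVertex G 2 1 a)
                        (v₃∼ₕw : adjH G v₃ w ≡ true)
                        (H-neighbours : ∀ {z} → adjH G v₃ z ≡ true → z ∈ v ∷ a ∷ w ∷ []) where

      open ThreeVertex v₃-3-vertex (adjH-sym v∼ₕv₃)
      open Neighbours H-neighbours

      v₃∼a : v₃ ∼ a
      v₃∼a = adjH⇒∼ v₃∼ₕa

      v₃≢2-vertex : ∀ {z} → degH G z ≡ 2 → v₃ ≢ z
      v₃≢2-vertex dHz = degH-separates (proj₂ v₃-3-vertex) dHz λ ()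

      Tₐ : TwoOneVertex a v₃
      Tₐ = twoOneVertex a-2₁ (adjH-sym v₃∼ₕa) (λ dHv₃≡2 → v₃≢2-vertex dHv₃≡2 refl)

      open TwoOneVertex Tₐ using ()
        renaming (partner to a′; x∼partner to a∼a′; partner≢y to a′≢v₃; degH-partner to degH-a′)

      ds : List Vertex
      ds = v₁ ∷ v₂ ∷ a ∷ pendants

      coloured : List Edge → EdgeSet
      coloured = colouredBy ds

      es₁ es₂ es₃ es : List Edge
      es₁ = (v₃ , a) ∷ []
      es₂ = (v , v₁) ∷ es₁
      es₃ = (v , v₂) ∷ es₂
      es  = (a , a′) ∷ (v₂ , u₂) ∷ (v₁ , u₁) ∷ map (v₃ ,_) pendants ++ es₃

      pendant-edges-uncoloured : ∀ es′ → (∀ {p} → p ∈ pendants → All (Avoids p v₃) es′) →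
                                 ∀ {p} → p ∈ pendants → coloured es′ v₃ p ≡ false
      pendant-edges-uncoloured es′ avoid {p} p∈ =
        trans (colouredBy-sym ds es′ v₃ p) (colouredBy-∉ {ds} es′ v₃ (there (there (there p∈))) (avoid p∈))

      v₃a-avoids-pendants : ∀ {p} → p ∈ pendants → Avoids p v₃ (v₃ , a)
      v₃a-avoids-pendants p∈ =
        isEdge-missʳ (inH≢pendant (adjH⇒inHʳ v₃∼ₕa) (proj₂ (pendants⁻ p∈))) (≢-sym (∼-irrefl v₃∼a))

      vv₁-avoids-pendants : ∀ {p} → p ∈ pendants → Avoids p v₃ (v , v₁)
      vv₁-avoids-pendants p∈ = isEdge-missˡ (inH≢pendant (proj₁ v-4-vertex) (proj₂ (pendants⁻ p∈))) (∼-irrefl v∼v₃)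

      -- only the edge vv₄ is coloured at v besides vv₃, since v₁ and v₂ are deleted
      colouredAt-v≤1 : colouredAt (coloured []) v v₃ ≤ 1
      colouredAt-v≤1 = colouredAt≤candidates {coloured []} (v₄ ∷ []) candidate
        where
        candidate : ∀ {b} → v ∼ b → b ≢ v₃ → coloured [] v b ≡ true → b ∈ v₄ ∷ []
        candidate v∼b b≢v₃ vb-coloured with v-neighbours v∼b
        ... | here refl                  with () ← trans (sym vb-coloured) (outside-deletedʳ {ds} v (here refl))
        ... | there (here refl)          with () ← trans (sym vb-coloured) (outside-deletedʳ {ds} v (there (here refl)))
        ... | there (there (here b≡v₃))  = contradiction b≡v₃ b≢v₃
        ... | there (there (there b∈v₄)) = b∈v₄

      bound₀ : conflicts (coloured []) v₃ a ≤ 6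
      bound₀ = m≤n⇒m≤1+n (+-mono-≤ from-v₃ (twoOne-conflictsFrom≤1 Tₐ))
        where
        others : ∀ {z} → v₃ ∼ z → z ≢ a → inH G z → z ∈ v ∷ w ∷ []
        others v₃∼z z≢a z∈H with neighbour-in-H v₃∼z z∈H
        ... | here z≡v          = here z≡v
        ... | there (here z≡a)  = contradiction z≡a z≢a
        ... | there (there z∈w) = there z∈w
        from-v₃ : conflictsFrom (coloured []) v₃ a ≤ 4
        from-v₃ = ≤-trans (conflictsFrom≤candidates (v ∷ w ∷ []) others)
                          (+-mono-≤ colouredAt-v≤1 (+-mono-≤ (colouredAt≤3 {coloured []} (∼-sym (adjH⇒∼ v₃∼ₕw))) z≤n))

      bound₁ : conflicts (coloured es₁) v v₁ ≤ 6
      bound₁ = conflicts-vv₁ {coloured es₁}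
        (+-mono-≤ (≤-reflexive (twoOne-uncoloured T₂ {coloured es₁}
                                  (colouredBy-∉ {ds} es₁ u₂ (there (here refl)) v₂u₂-avoids)))
                  (colouredAt≤2 {coloured es₁} (pendant-edges-uncoloured es₁ λ p∈ → v₃a-avoids-pendants p∈ ∷ [])))
        where
        v₂u₂-avoids : All (Avoids v₂ u₂) es₁
        v₂u₂-avoids = isEdge-missˡ (≢-sym v₂≢v₃) (v₃≢2-vertex degH-u₂) ∷ []

      bound₂ : conflicts (coloured es₂) v v₂ ≤ 6
      bound₂ = conflicts-vv₂ {coloured es₂}
        (+-mono-≤ (≤-reflexive (twoOne-uncoloured T₁ {coloured es₂} (colouredBy-∉ {ds} es₂ u₁ (here refl) v₁u₁-avoids)))
                  (colouredAt≤2 {coloured es₂}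
                    (pendant-edges-uncoloured es₂ λ p∈ → vv₁-avoids-pendants p∈ ∷ v₃a-avoids-pendants p∈ ∷ [])))
        where
        v₁u₁-avoids : All (Avoids v₁ u₁) es₂
        v₁u₁-avoids = isEdge-missˡ (∼-irrefl v∼v₁) (v≢2-vertex degH-u₁) ∷
                      isEdge-missˡ (≢-sym v₁≢v₃) (v₃≢2-vertex degH-u₁) ∷ []

      bound-pendant : ∀ {p} → p ∈ pendants → conflicts (coloured es₃) v₃ p ≤ 6
      bound-pendant p∈ = pendant-conflicts {coloured es₃} p∈
        (+-mono-≤ (≤-reflexive (twoOne-uncoloured Tₐ {coloured es₃}
                                  (colouredBy-∉ {ds} es₃ a′ (there (there (here refl))) aa′-avoids)))
                  (colouredAt≤3 {coloured es₃} (∼-sym (adjH⇒∼ v₃∼ₕw))))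
        where
        v≢a : v ≢ a
        v≢a = v≢2-vertex (proj₂ (proj₁ a-2₁))
        v≢a′ : v ≢ a′
        v≢a′ = v≢2-vertex degH-a′
        aa′-avoids : All (Avoids a a′) es₃
        aa′-avoids = isEdge-missˡ v≢a v≢a′ ∷ isEdge-missˡ v≢a v≢a′ ∷ isEdge-missˡ (∼-irrefl v₃∼a) (≢-sym a′≢v₃) ∷ []

      colourable : Colourable (coloured es)
      colourable = extend (extend (extend (colour-pendants stage₃ bound-pendant) v₁∼u₁ (twoOne-safe T₁))
                                  v₂∼u₂ (twoOne-safe T₂))
                          a∼a′ (twoOne-safe Tₐ)
        where
        stage₃ : Colourable (coloured es₃)
        stage₃ = extend (extend (extend (colourable-after-deletion mc {ds} v∼v₁ (here refl)) v₃∼a bound₀) v∼v₁ bound₁)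
                        v∼v₂ bound₂

      earlier : ∀ {e} → e ∈ es₃ → e ∈ es
      earlier e∈ = there (there (there (∈-++⁺ʳ (map (v₃ ,_) pendants) e∈)))

      covered : ∀ {u w} → u ∈ ds → u ∼ w → Listed u w es
      covered (here refl)                 = twoOne-covered T₁ (earlier (there (here refl))) (there (there (here refl)))
      covered (there (here refl))         = twoOne-covered T₂ (earlier (here refl)) (there (here refl))
      covered (there (there (here refl))) = twoOne-covered Tₐ (earlier (there (there (here refl)))) (here refl)
      covered (there (there (there p∈)))  = pendant-covered p∈ (there (there (there (∈-++⁺ˡ (∈-map⁺ (v₃ ,_) p∈)))))

      impossible : ⊥
      impossible = reducible mc colourable covered

    v₃-not-3₁⁺ : ¬ Three1Plus G v₃
    v₃-not-3₁⁺ ((v₃-3-vertex , _) , a , v₃∼ₕa , a-2₁) =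
      let (w , v₃∼ₕw , H-neighbours) =
            ThreeVertex.H-neighbours-beyond v₃-3-vertex (adjH-sym v∼ₕv₃) v₃∼ₕa (≢-sym (v≢2-vertex (proj₂ (proj₁ a-2₁))))
      in ThreeOnePlus.impossible v₃-3-vertex v₃∼ₕa a-2₁ v₃∼ₕw H-neighbours

lemma2p10 : (G : Graph) → MinimalCounterexample G →
    (v v₁ v₂ v₃ v₄ : Fin (n G)) →
    KVertex G 4 v →
    adjH G v v₁ ≡ true → adjH G v v₂ ≡ true → adjH G v v₃ ≡ true → adjH G v v₄ ≡ true →
    v₁ ≢ v₂ → v₁ ≢ v₃ → v₁ ≢ v₄ → v₂ ≢ v₃ → v₂ ≢ v₄ → v₃ ≢ v₄ →
    KJVertex G 2 1 v₁ → KJVertex G 2 1 v₂ →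
    (¬ KVertex G 2 v₃ × ¬ Poor G v₃) × (¬ KVertex G 2 v₄ × ¬ Poor G v₄)
lemma2p10 G mc v v₁ v₂ v₃ v₄ v-4-vertex a₁ a₂ a₃ a₄ d₁₂ d₁₃ d₁₄ d₂₃ d₂₄ d₃₄ k₁ k₂ =
  (At-v₃.v₃-not-2-vertex , [ At-v₃.v₃-not-3₁⁺ , At-v₃.v₃-not-3₂ ]′) ,
  (At-v₄.v₃-not-2-vertex , [ At-v₄.v₃-not-3₁⁺ , At-v₄.v₃-not-3₂ ]′)
  where
  open Minimal G mc
  -- the configuration is symmetric in v₃ and v₄
  module At-v₃ = FourVertex v-4-vertex a₁ a₂ a₃ a₄ d₁₂ d₁₃ d₁₄ d₂₃ d₂₄ d₃₄ k₁ k₂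
  module At-v₄ = FourVertex v-4-vertex a₁ a₂ a₄ a₃ d₁₂ d₁₄ d₁₃ d₂₄ d₂₃ (≢-sym d₃₄) k₁ k₂
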